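{- The map $\theta$ defined below restricts to (1) a bijection between binary tubings of ladders (plane rooted trees in which every vertex has at most one child) and connected 213-avoiding permutation chord diagrams, and (2) a bijection between leaf tubings (of plane rooted trees) and 1-terminal chord diagrams.
   Context: A plane rooted tree is a root with an ordered list of plane rooted trees as children. A tube is a vertex set inducing a connected subgraph; a binary tubing $\tau$ of $t$ is a set of tubes containing $V(t)$ such that each tube is a single vertex or is partitioned by two other tubes of $\tau$. If $t$ has $\ge2$ vertices, the two tubes partitioning $V(t)$ are the vertex sets of a rooted subtree $t'$ (a non-root vertex and all descendants) and $t''=t\setminus t'$; $\tau$ restricts to tubings $\tau',\tau''$ of them. A leaf tubing is a binary tubing in which, whenever a tube of size $\ge2$ is partitioned by two tubes, one of them is a single vertex which is a leaf of the tree induced by the partitioned tube (and the other is the rest). RTIPs of a plane rooted tree: at each vertex a place before the first child, between consecutive children, after the last child; ordered recursively: for root with subtrees $t_1,\dots,t_k$: place before $t_1$, places of $t_1$, place between $t_1,t_2$, places of $t_2$, ..., place after $t_k$. A rooted chord diagram of size $n$ is a set of pairs $(a_j,b_j)$, $a_j<b_j$, partitioning $\{1,\dots,2n\}$; root chord has $a_j=1$. Chords $(a,b),(a',b')$ cross if $a<a'<b<b'$ or $a'<a<b'<b$; connected means the crossing graph is connected. A chord $(a,b)$ is terminal if there is no chord $(a',b')$ with $a<a'<b<b'$; 1-terminal means exactly one terminal chord. A permutation diagram is one where all sinks $b_j$ lie to the right of all sources $a_j$; labelling sinks by the left-to-right order of their sources gives a permutation; the diagram is 213-avoiding if this permutation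 avoids the pattern 213. $\theta$: the one-vertex tubing maps to the one-chord diagram. Otherwise let $C''=\theta(\tau'')$ (size $n''$), $C'=\theta(\tau')$ (size $m$, root chord $(1,k)$), and $t'$ attached to $t''$ at its $i$-th RTIP. Then $\theta(\tau)$ has points $\{1,\dots,2n''+2m\}$ and chords $(1,k+i)$; $(a+i,b+i)$ for each non-root chord $(a,b)$ of $C'$; and each chord of $C''$ with each endpoint $p$ replaced by $p+1$ if $p\le i$ and $p+2m$ if $p>i$. -}

module Defs where

open import Data.Nat using (ℕ; zero; suc; _+_; _*_; _∸_; _<_; _≤_; _<ᵇ_; _≤ᵇ_; _≡ᵇ_)
open import Data.Fin using (Fin; toℕ)
open import Data.Bool using (if_then_else_; not)
open import Data.List using (List; []; _∷_; _++_; map; length; concatMap; upTo; filterᵇ)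
open import Data.List.Membership.Propositional using (_∈_)
open import Data.List.Relation.Binary.Permutation.Propositional using (_↭_)
open import Data.List.Relation.Unary.All using (All)
open import Data.Product using (Σ; ∃; _×_; _,_; proj₁; proj₂)
open import Data.Sum using (_⊎_)
open import Relation.Nullary using (¬_)
open import Relation.Binary.PropositionalEquality using (_≡_; _≢_)
open import Relation.Binary.Construct.Closure.ReflexiveTransitive using (Star)

data PTree : Set where
  node : List PTree → PTree

children : PTree → List PTree
children (node ts) = ts

data IsLadder : PTree → Set where
  single : IsLadder (node [])
  step   : {t : PTree} → IsLadder t → IsLadder (node (t ∷ []))

-- A vertex with k children has k+1 places; they are ordered
-- recursively: place before t₁, places of t₁, place between t₁ and t₂,
-- places of t₂, …, place after t_k.  We index them from 0
-- (so the paper's i-th RTIP is our index i-1).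

mutual
  rtips : PTree → ℕ
  rtips (node ts) = suc (rtipsL ts)

  rtipsL : List PTree → ℕ
  rtipsL []       = 0
  rtipsL (t ∷ ts) = rtips t + suc (rtipsL ts)

-- insert t i s : the tree obtained by attaching s (as a new child) to t at
-- its RTIP number i (0-based).  Out-of-range indices never occur below
-- (indices are drawn from Fin (rtips t)).
mutual
  insert : PTree → ℕ → PTree → PTree
  insert (node ts) i s = node (insertL ts i s)

  insertL : List PTree → ℕ → PTree → List PTree
  insertL ts       zero    s = s ∷ ts
  insertL []       (suc i) s = []
  insertL (t ∷ ts) (suc i) s =
    if i <ᵇ rtips t then insert t i s ∷ ts
                    else t ∷ insertL ts (i ∸ rtips t) s

-- Binary tubings, represented by their (unique) recursive decomposition:
-- a binary tubing of a tree t with ≥ 2 vertices consists of the two tubes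
-- partitioning V(t), namely V(t') for a rooted subtree t' (a non-root
-- vertex and its descendants) and V(t'') with t'' = t ∖ t', together with
-- binary tubings τ' of t' and τ'' of t''.  Choosing the non-root vertex is
-- the same as choosing t', t'' and the RTIP of t'' at which t' hangs.

data Tubing : PTree → Set where
  vert  : Tubing (node [])
  graft : {t' t'' : PTree} → Tubing t' → Tubing t'' → (i : Fin (rtips t'')) →
          Tubing (insert t'' (toℕ i) t')

-- In the split of
-- t = insert t'' i t' the single-vertex candidate parts are:
--   * t' (its vertex v has in t exactly the children of t', so v is a leaf
--     of t iff t' = node []), or
--   * t'' (its vertex is the root of t, a leaf of t iff t has no children).
LeafSplit : (t' t'' : PTree) → (i : Fin (rtips t'')) → Set
LeafSplit t' t'' i =
  (t' ≡ node []) ⊎ (t'' ≡ node [] × children (insert t'' (toℕ i) t') ≡ [])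

data IsLeafTubing : {t : PTree} → Tubing t → Set where
  vert  : IsLeafTubing vert
  graft : {t' t'' : PTree} {τ' : Tubing t'} {τ'' : Tubing t''} {i : Fin (rtips t'')} →
          LeafSplit t' t'' i → IsLeafTubing τ' → IsLeafTubing τ'' →
          IsLeafTubing (graft τ' τ'' i)

-- Chord diagrams: a finite set of chords (a , b), represented by a list
-- (sets are compared up to permutation, _↭_; valid diagrams have no
-- repeated chords, so ↭ is equality of the underlying sets).

Chord : Set
Chord = ℕ × ℕ

Diagram : Set
Diagram = List Chord

endpoints : Diagram → List ℕ
endpoints = concatMap (λ c → proj₁ c ∷ proj₂ c ∷ [])

range1 : ℕ → List ℕ
range1 n = map suc (upTo n)

-- Rooted chord diagram of size n = length C ≥ 1: chords (a , b) with a < b,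
-- partitioning {1,…,2n}.  (Nonempty, so that there is a root chord.)
IsRootedChordDiagram : Diagram → Set
IsRootedChordDiagram C =
  (C ≢ []) × All (λ c → proj₁ c < proj₂ c) C × (endpoints C ↭ range1 (2 * length C))

Crosses : Chord → Chord → Set
Crosses (a , b) (a' , b') = (a < a' × a' < b × b < b') ⊎ (a' < a × a < b' × b' < b)

CrossIn : Diagram → Chord → Chord → Set
CrossIn C c d = c ∈ C × d ∈ C × Crosses c d

Connected : Diagram → Set
Connected C = ∀ {c d} → c ∈ C → d ∈ C → Star (CrossIn C) c d

Terminal : Diagram → Chord → Set
Terminal C (a , b) = ¬ (Σ Chord λ d → d ∈ C × (a < proj₁ d × proj₁ d < b × b < proj₂ d))

OneTerminal : Diagram → Set
OneTerminal C = Σ Chord λ c → c ∈ C × Terminal C c × (∀ d → d ∈ C → Terminal C d → d ≡ c)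

IsPermutationDiagram : Diagram → Set
IsPermutationDiagram C = ∀ {c d} → c ∈ C → d ∈ C → proj₁ c < proj₂ d

-- The permutation labels each sink by the rank of its source.  It contains
-- 213 iff there are sinks b₁ < b₂ < b₃ whose labels satisfy
-- label b₂ < label b₁ < label b₃, i.e. whose sources satisfy a₂ < a₁ < a₃
-- (ranks of sources compare like the sources themselves).
Contains213 : Diagram → Set
Contains213 C = Σ Chord λ c₁ → Σ Chord λ c₂ → Σ Chord λ c₃ →
  c₁ ∈ C × c₂ ∈ C × c₃ ∈ C ×
  (proj₂ c₁ < proj₂ c₂ × proj₂ c₂ < proj₂ c₃) ×
  (proj₁ c₂ < proj₁ c₁ × proj₁ c₁ < proj₁ c₃)

Connected213PermDiagram : Diagram → Set
Connected213PermDiagram C =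
  IsRootedChordDiagram C × Connected C × IsPermutationDiagram C × ¬ Contains213 C

OneTerminalDiagram : Diagram → Set
OneTerminalDiagram C = IsRootedChordDiagram C × OneTerminal C

rootSink : Diagram → ℕ
rootSink []            = 0
rootSink ((a , b) ∷ C) = if a ≡ᵇ 1 then b else rootSink C

nonRootChords : Diagram → Diagram
nonRootChords = filterᵇ (λ c → not (proj₁ c ≡ᵇ 1))

θ : {t : PTree} → Tubing t → Diagram
θ vert = (1 , 2) ∷ []
θ (graft {t'} {t''} τ' τ'' i) =
  (1 , k + j) ∷ map (λ c → (proj₁ c + j , proj₂ c + j)) (nonRootChords C')
              ++ map (λ c → (f (proj₁ c) , f (proj₂ c))) C''
  where
  C'  = θ τ'
  C'' = θ τ''
  m   = length C'
  k   = rootSink C'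
  j   = suc (toℕ i)          -- the paper's (1-based) RTIP index i
  f : ℕ → ℕ
  f p = if p ≤ᵇ j then suc p else p + 2 * m

record RestrictsToBijection (P : {t : PTree} → Tubing t → Set) (Q : Diagram → Set) : Set where
  field
    into       : ∀ {t} (τ : Tubing t) → P τ → Q (θ τ)
    injective  : ∀ {t₁ t₂} (τ₁ : Tubing t₁) (τ₂ : Tubing t₂) → P τ₁ → P τ₂ →
                 θ τ₁ ↭ θ τ₂ → _≡_ {A = Σ PTree Tubing} (t₁ , τ₁) (t₂ , τ₂)
    surjective : ∀ C → Q C → Σ PTree λ t → Σ (Tubing t) λ τ → P τ × (θ τ ↭ C)

module Submission where

-- θ (graft τ' τ'' i) nests the relabelled θ τ' inside the new root chord (1 , k + j) and
-- spreads θ τ'' around it, so by induction θ τ is a chord diagram on 2 |t| points.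
--
-- A ladder is always grafted at its last place. Then θ τ has sources 1, …, n and root chord
-- (1 , n + 1), which crosses every other chord, and no 213 pattern arises. Conversely, in a
-- connected 213-avoiding permutation diagram the root chord must be (1 , n + 1), and the sink
-- s₂ of the chord starting at 2 separates the remaining chords into the images of two smaller
-- diagrams of the same kind.
--
-- In a leaf tubing the inner part is a single vertex, so θ surrounds the relabelled θ τ'' by a
-- root chord (1 , j + 2). This chord is never terminal and the other terminal chords correspond,
-- so exactly one terminal chord survives; conversely, removing the root chord of a 1-terminal
-- diagram leaves a 1-terminal diagram.
--
-- In both cases the place j, the sizes and the two parts can be read off θ τ, which gives
-- injectivity.

open import Defs
open import Axiom.UniquenessOfIdentityProofs using (module Decidable⇒UIP)
open import Data.Bool using (true; false; T; if_then_else_)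
open import Data.Empty using (⊥; ⊥-elim)
open import Data.Fin using (Fin; toℕ; fromℕ<)
open import Data.Fin.Properties using (toℕ<n; toℕ-fromℕ<; toℕ-injective)
open import Data.List using (List; []; _∷_; _++_; map; length; upTo; filter; drop)
open import Data.List.Properties using (length-++; length-map; length-upTo; ∷-injectiveʳ; map-∘; map-id-local)
open import Data.List.Membership.Propositional using (_∈_; _∉_)
open import Data.List.Membership.Propositional.Properties
open import Data.List.Membership.Setoid.Properties using (unique⇒irrelevant)
open import Data.List.Relation.Binary.BagAndSetEquality using (∼bag⇒↭)
open import Data.List.Relation.Binary.Permutation.Propositional
  using (_↭_; ↭-sym; ↭-trans; prep; ↭⇒↭ₛ)
open import Data.List.Relation.Binary.Permutation.Propositional.Properties
  using (shift; ∈-resp-↭; ↭-length; drop-∷; ++⁺; map⁺)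
import Data.List.Relation.Binary.Permutation.Setoid.Properties as ↭ₛ
open import Data.List.Relation.Binary.Subset.Propositional using (_⊆_)
open import Data.List.Relation.Unary.All using (All; []; _∷_)
import Data.List.Relation.Unary.All as All
import Data.List.Relation.Unary.All.Properties as All
open import Data.List.Relation.Unary.AllPairs using ([]; _∷_)
import Data.List.Relation.Unary.AllPairs as AllPairs
open import Data.List.Relation.Unary.Any using (here; there)
open import Data.List.Relation.Unary.Unique.Propositional using (Unique)
import Data.List.Relation.Unary.Unique.Propositional.Properties as Unique
open import Data.Nat using (ℕ; zero; suc; _+_; _*_; _∸_; _<_; _≤_; z≤n; s≤s; _<ᵇ_; _≤ᵇ_; _≟_; _≤?_; _<?_)
open import Data.Nat.Induction using (<-rec)
open import Data.Nat.Properties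
open import Data.List.Extrema ≤-totalOrder using (argmax; argmax-sel; f[xs]≤f[argmax])
open import Data.Product using (Σ; ∃; _×_; _,_; proj₁; proj₂; uncurry)
open import Data.Product.Properties using (≡-dec)
open import Data.Sum using (_⊎_; inj₁; inj₂)
open import Data.Unit using (tt)
open import Function.Base using (_∘_; flip; id)
open import Function.Bundles using (mk↔ₛ′)
open import Function.Definitions using (Injective)
open import Relation.Binary.Construct.Closure.ReflexiveTransitive using (Star; ε; _◅_; _◅◅_; fold)
open import Relation.Binary.Definitions using (DecidableEquality; tri<; tri≈; tri>)
open import Relation.Binary.PropositionalEquality
  using (_≡_; _≢_; refl; sym; trans; cong; cong₂; subst; subst₂; setoid; module ≡-Reasoning)
open import Relation.Nullary using (¬_; Dec; yes; no)
open import Relation.Nullary.Decidable using (_×-dec_; ¬?)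

module _ {A : Set} (_≟_ : DecidableEquality A) where

  ⊆∧⊇⇒↭ : {xs ys : List A} → Unique xs → Unique ys → xs ⊆ ys → ys ⊆ xs → xs ↭ ys
  ⊆∧⊇⇒↭ uxs uys xs⊆ys ys⊆xs = ∼bag⇒↭ (mk↔ₛ′ xs⊆ys ys⊆xs
    (λ _ → unique⇒irrelevant (setoid A) (Decidable⇒UIP.≡-irrelevant _≟_) uys _ _)
    (λ _ → unique⇒irrelevant (setoid A) (Decidable⇒UIP.≡-irrelevant _≟_) uxs _ _))

  map-↭⁻ : {B : Set} (f : A → B) → Injective _≡_ _≡_ f → {xs ys : List A} →
           Unique xs → Unique ys → map f xs ↭ map f ys → xs ↭ ys
  map-↭⁻ f f-inj uxs uys p = ⊆∧⊇⇒↭ uxs uys (pull p) (pull (↭-sym p))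
    where
    pull : ∀ {us vs} → map f us ↭ map f vs → us ⊆ vs
    pull {vs = vs} q z∈ with ∈-map⁻ f (∈-resp-↭ q (∈-map⁺ f z∈))
    ... | y , y∈ , fz≡fy = subst (_∈ vs) (sym (f-inj fz≡fy)) y∈

module _ {A : Set} where

  Unique-resp-↭ : {xs ys : List A} → xs ↭ ys → Unique xs → Unique ys
  Unique-resp-↭ p = ↭ₛ.Unique-resp-↭ (setoid A) (↭⇒↭ₛ p)

  Unique-++⁻ˡ : ∀ (xs : List A) {ys} → Unique (xs ++ ys) → Unique xs
  Unique-++⁻ˡ []       _       = []
  Unique-++⁻ˡ (x ∷ xs) (a ∷ u) = All.++⁻ˡ xs a ∷ Unique-++⁻ˡ xs u

  Unique-++⁻ʳ : ∀ (xs : List A) {ys} → Unique (xs ++ ys) → Unique ys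
  Unique-++⁻ʳ []       u       = u
  Unique-++⁻ʳ (x ∷ xs) (_ ∷ u) = Unique-++⁻ʳ xs u

  Unique-map⁺-on : {B : Set} (f : A → B) {xs : List A} → Unique xs →
                   (∀ {x y} → x ∈ xs → y ∈ xs → f x ≡ f y → x ≡ y) → Unique (map f xs)
  Unique-map⁺-on f {[]}     _        _   = []
  Unique-map⁺-on f {x ∷ xs} (x∉ ∷ u) inj =
    All.tabulate fx≢ ∷ Unique-map⁺-on f u (λ p q → inj (there p) (there q))
    where
    fx≢ : ∀ {z} → z ∈ map f xs → f x ≢ z
    fx≢ z∈ fx≡z with ∈-map⁻ f z∈
    ... | y , y∈ , refl = All.lookup x∉ y∈ (inj (here refl) (there y∈) fx≡z)

interval-length : ∀ {xs : List ℕ} lo n → Unique xs →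
                  (∀ {x} → x ∈ xs → lo ≤ x × x < lo + n) →
                  (∀ {x} → lo ≤ x → x < lo + n → x ∈ xs) → length xs ≡ n
interval-length {xs} lo n uxs inside complete = begin
  length xs                      ≡⟨ ↭-length (⊆∧⊇⇒↭ _≟_ uxs unique-interval to from) ⟩
  length (map (lo +_) (upTo n))  ≡⟨ length-map (lo +_) (upTo n) ⟩
  length (upTo n)                ≡⟨ length-upTo n ⟩
  n                              ∎
  where
  open ≡-Reasoning
  unique-interval : Unique (map (lo +_) (upTo n))
  unique-interval = Unique.map⁺ (+-cancelˡ-≡ lo _ _) (Unique.upTo⁺ n)
  to : xs ⊆ map (lo +_) (upTo n)
  to {x} x∈ with inside x∈
  ... | lo≤x , x<lo+n = subst (_∈ map (lo +_) (upTo n)) (m+[n∸m]≡n lo≤x)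
    (∈-map⁺ (lo +_) (∈-upTo⁺ (+-cancelˡ-< lo (x ∸ lo) n
      (subst (_< lo + n) (sym (m+[n∸m]≡n lo≤x)) x<lo+n))))
  from : map (lo +_) (upTo n) ⊆ xs
  from x∈ with ∈-map⁻ (lo +_) x∈
  ... | y , y∈ , refl = complete (m≤m+n lo y) (+-monoʳ-< lo (∈-upTo⁻ y∈))

<ᵇ≡true⇒< : ∀ m n → (m <ᵇ n) ≡ true → m < n
<ᵇ≡true⇒< m n e = <ᵇ⇒< m n (subst T (sym e) tt)

<ᵇ≡false⇒≥ : ∀ m n → (m <ᵇ n) ≡ false → n ≤ m
<ᵇ≡false⇒≥ m n e = ≮⇒≥ (λ m<n → subst T e (<⇒<ᵇ m<n))

≤ᵇ≡true⇒≤ : ∀ m n → (m ≤ᵇ n) ≡ true → m ≤ n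
≤ᵇ≡true⇒≤ m n e = ≤ᵇ⇒≤ m n (subst T (sym e) tt)

≤ᵇ≡false⇒> : ∀ m n → (m ≤ᵇ n) ≡ false → n < m
≤ᵇ≡false⇒> m n e = ≰⇒> (λ m≤n → subst T e (≤⇒≤ᵇ m≤n))

StrictlyMonotone : (ℕ → ℕ) → Set
StrictlyMonotone f = ∀ {p q} → p < q → f p < f q

module _ {f : ℕ → ℕ} (f-mono : StrictlyMonotone f) where

  monotone-reflects-< : ∀ {p q} → f p < f q → p < q
  monotone-reflects-< {p} {q} fp<fq with <-cmp p q
  ... | tri< p<q _ _ = p<q
  ... | tri≈ _ refl _ = ⊥-elim (<-irrefl refl fp<fq)
  ... | tri> _ _ q<p = ⊥-elim (<-asym fp<fq (f-mono q<p))

  monotone⇒injective : Injective _≡_ _≡_ f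
  monotone⇒injective {p} {q} fp≡fq with <-cmp p q
  ... | tri< p<q _ _ = ⊥-elim (<⇒≢ (f-mono p<q) fp≡fq)
  ... | tri≈ _ p≡q _ = p≡q
  ... | tri> _ _ q<p = ⊥-elim (<⇒≢ (f-mono q<p) (sym fp≡fq))

≥1∧≢1⇒≥2 : ∀ {x} → 1 ≤ x → x ≢ 1 → 2 ≤ x
≥1∧≢1⇒≥2 {suc zero}    _ x≢1 = ⊥-elim (x≢1 refl)
≥1∧≢1⇒≥2 {suc (suc _)} _ _   = s≤s (s≤s z≤n)

n<2*n : ∀ {n} → 1 ≤ n → n < 2 * n
n<2*n {n} 1≤n = subst (suc n ≤_) (cong (n +_) (sym (+-identityʳ n)))
                  (subst (_≤ n + n) (+-comm n 1) (+-monoʳ-≤ n 1≤n))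

mutual
  size : PTree → ℕ
  size (node ts) = suc (sizeL ts)

  sizeL : List PTree → ℕ
  sizeL []       = 0
  sizeL (t ∷ ts) = size t + sizeL ts

1≤size : ∀ t → 1 ≤ size t
1≤size (node ts) = s≤s z≤n

mutual
  suc-rtips≡2*size : ∀ t → suc (rtips t) ≡ 2 * size t
  suc-rtips≡2*size (node ts) =
    cong suc (trans (cong suc (rtipsL≡2*sizeL ts)) (sym (+-suc (sizeL ts) (sizeL ts + 0))))

  rtipsL≡2*sizeL : ∀ ts → rtipsL ts ≡ 2 * sizeL ts
  rtipsL≡2*sizeL []       = refl
  rtipsL≡2*sizeL (t ∷ ts) = begin
    rtips t + suc (rtipsL ts)  ≡⟨ +-suc (rtips t) (rtipsL ts) ⟩
    suc (rtips t) + rtipsL ts  ≡⟨ cong₂ _+_ (suc-rtips≡2*size t) (rtipsL≡2*sizeL ts) ⟩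
    2 * size t + 2 * sizeL ts  ≡⟨ *-distribˡ-+ 2 (size t) (sizeL ts) ⟨
    2 * (size t + sizeL ts)    ∎
    where open ≡-Reasoning

size≤rtips : ∀ t → size t ≤ rtips t
size≤rtips t = ≤-pred (begin
  suc (size t)        ≡⟨ +-comm 1 (size t) ⟩
  size t + 1          ≤⟨ +-monoʳ-≤ (size t) (1≤size t) ⟩
  size t + size t     ≡⟨ cong (size t +_) (+-identityʳ (size t)) ⟨
  2 * size t          ≡⟨ suc-rtips≡2*size t ⟨
  suc (rtips t)       ∎)
  where open ≤-Reasoning

rtipsL-tail : ∀ t ts {i} → suc i ≤ rtipsL (t ∷ ts) → i ∸ rtips t ≤ rtipsL ts
rtipsL-tail t ts {i} i<tips =
  m≤n+o⇒m∸n≤o i (rtips t) (≤-pred (subst (suc i ≤_) (+-suc (rtips t) (rtipsL ts)) i<tips))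

mutual
  size-insert : ∀ t i s → i < rtips t → size (insert t i s) ≡ size t + size s
  size-insert (node ts) i s (s≤s i≤tips) = cong suc (size-insertL ts i s i≤tips)

  size-insertL : ∀ ts i s → i ≤ rtipsL ts → sizeL (insertL ts i s) ≡ sizeL ts + size s
  size-insertL ts zero s _ = +-comm (size s) (sizeL ts)
  size-insertL (t ∷ ts) (suc i) s i<tips with i <ᵇ rtips t in eq
  ... | true = begin
    size (insert t i s) + sizeL ts  ≡⟨ cong (_+ sizeL ts) (size-insert t i s (<ᵇ≡true⇒< _ _ eq)) ⟩
    size t + size s + sizeL ts      ≡⟨ +-assoc (size t) (size s) (sizeL ts) ⟩
    size t + (size s + sizeL ts)    ≡⟨ cong (size t +_) (+-comm (size s) (sizeL ts)) ⟩
    size t + (sizeL ts + size s)    ≡⟨ +-assoc (size t) (sizeL ts) (size s) ⟨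
    size t + sizeL ts + size s      ∎
    where open ≡-Reasoning
  ... | false = trans (cong (size t +_) (size-insertL ts (i ∸ rtips t) s (rtipsL-tail t ts i<tips)))
                      (sym (+-assoc (size t) (sizeL ts) (size s)))

insertL≢[] : ∀ ts i s → i ≤ rtipsL ts → insertL ts i s ≢ []
insertL≢[] ts       zero    s _ ()
insertL≢[] (t ∷ ts) (suc i) s _ with i <ᵇ rtips t
... | true  = λ ()
... | false = λ ()

insert≢leaf : ∀ t i s → i < rtips t → insert t i s ≢ node []
insert≢leaf (node ts) i s (s≤s i≤tips) e = insertL≢[] ts i s i≤tips (cong children e)

ladder-children : ∀ {ts} → IsLadder (node ts) → ts ≡ [] ⊎ ∃ λ c → ts ≡ c ∷ [] × IsLadder c
ladder-children single   = inj₁ refl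
ladder-children (step l) = inj₂ (_ , refl , l)

ladder-insert⁻ : ∀ t i s → i < rtips t → IsLadder (insert t i s) →
                 IsLadder t × IsLadder s × suc i ≡ size t
ladder-insert⁻ (node [])       zero    s _         (step l) = single , l , refl
ladder-insert⁻ (node [])       (suc i) s (s≤s ()) _
ladder-insert⁻ (node (c ∷ cs)) zero    s _         l with ladder-children l
... | inj₁ ()
... | inj₂ (_ , () , _)
ladder-insert⁻ (node (c ∷ cs)) (suc i) s (s≤s i<tips) l with i <ᵇ rtips c in eq | ladder-children l
... | true  | inj₁ ()
... | true  | inj₂ (_ , refl , l′) with ladder-insert⁻ c i s (<ᵇ≡true⇒< _ _ eq) l′
...   | lc , ls , e = step lc , ls , cong suc (trans e (sym (+-identityʳ (size c))))
ladder-insert⁻ (node (c ∷ cs)) (suc i) s (s≤s i<tips) l | false | inj₁ ()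
ladder-insert⁻ (node (c ∷ cs)) (suc i) s (s≤s i<tips) l | false | inj₂ (_ , e , _) =
  ⊥-elim (insertL≢[] cs (i ∸ rtips c) s (rtipsL-tail c cs i<tips) (∷-injectiveʳ e))

ladder-insert⁺ : ∀ t s i → IsLadder t → IsLadder s → suc i ≡ size t → IsLadder (insert t i s)
ladder-insert⁺ _ s zero    single             ls e  = step ls
ladder-insert⁺ _ s zero    (step {node _} lc) ls ()
ladder-insert⁺ _ s (suc i) (step {c} lc)      ls e with i <ᵇ rtips c in eq
... | true  = step (ladder-insert⁺ c s i lc ls i+1≡size)
  where i+1≡size = trans (suc-injective e) (+-identityʳ (size c))
... | false = ⊥-elim (<⇒≱ (subst (_≤ rtips c) (sym i+1≡size) (size≤rtips c)) (<ᵇ≡false⇒≥ _ _ eq))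
  where i+1≡size = trans (suc-injective e) (+-identityʳ (size c))

-- Chord diagrams

_≟ᶜ_ : DecidableEquality Chord
_≟ᶜ_ = ≡-dec _≟_ _≟_

IsEndpoint : ℕ → Chord → Set
IsEndpoint x c = x ≡ proj₁ c ⊎ x ≡ proj₂ c

∈-endpoints⁻ : ∀ (C : Diagram) {x} → x ∈ endpoints C → ∃ λ c → c ∈ C × IsEndpoint x c
∈-endpoints⁻ (c ∷ C) (here refl)         = c , here refl , inj₁ refl
∈-endpoints⁻ (c ∷ C) (there (here refl)) = c , here refl , inj₂ refl
∈-endpoints⁻ (c ∷ C) (there (there q)) with ∈-endpoints⁻ C q
... | d , d∈ , x∈d = d , there d∈ , x∈d

∈-endpoints⁺ : ∀ {C : Diagram} {c x} → c ∈ C → IsEndpoint x c → x ∈ endpoints C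
∈-endpoints⁺ (here refl) (inj₁ refl) = here refl
∈-endpoints⁺ (here refl) (inj₂ refl) = there (here refl)
∈-endpoints⁺ (there q)   x∈c         = there (there (∈-endpoints⁺ q x∈c))

EndpointDisjoint : Diagram → Set
EndpointDisjoint C = ∀ {c d x} → c ∈ C → d ∈ C → IsEndpoint x c → IsEndpoint x d → c ≡ d

endpoints-unique⇒head-disjoint : ∀ {c C d x} → Unique (endpoints (c ∷ C)) → d ∈ C →
                                 IsEndpoint x c → IsEndpoint x d → ⊥
endpoints-unique⇒head-disjoint ((_ ∷ a∉) ∷ _ ∷ _) d∈ (inj₁ refl) x∈d = All.lookup a∉ (∈-endpoints⁺ d∈ x∈d) refl
endpoints-unique⇒head-disjoint (_ ∷ b∉ ∷ _)       d∈ (inj₂ refl) x∈d = All.lookup b∉ (∈-endpoints⁺ d∈ x∈d) refl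

endpoints-unique⇒disjoint : ∀ C → Unique (endpoints C) → EndpointDisjoint C
endpoints-unique⇒disjoint (c ∷ C) u (here refl) (here refl) _ _ = refl
endpoints-unique⇒disjoint (c ∷ C) u (here refl) (there d∈) x∈c x∈d =
  ⊥-elim (endpoints-unique⇒head-disjoint u d∈ x∈c x∈d)
endpoints-unique⇒disjoint (c ∷ C) u (there c∈) (here refl) x∈c x∈d =
  ⊥-elim (endpoints-unique⇒head-disjoint u c∈ x∈d x∈c)
endpoints-unique⇒disjoint (c ∷ C) (_ ∷ _ ∷ u) (there c∈) (there d∈) x∈c x∈d =
  endpoints-unique⇒disjoint C u c∈ d∈ x∈c x∈d

endpoints-unique⇒unique : ∀ C → Unique (endpoints C) → Unique C
endpoints-unique⇒unique []      _                     = []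
endpoints-unique⇒unique (c ∷ C) ((_ ∷ a∉) ∷ _ ∷ u) =
  All.tabulate (λ d∈ c≡d → All.lookup a∉ (∈-endpoints⁺ d∈ (inj₁ (cong proj₁ c≡d))) refl)
  ∷ endpoints-unique⇒unique C u

disjoint⇒endpoints-unique : ∀ C → Unique C → All (λ c → proj₁ c < proj₂ c) C →
                            EndpointDisjoint C → Unique (endpoints C)
disjoint⇒endpoints-unique []            _        _            _  = []
disjoint⇒endpoints-unique ((a , b) ∷ C) (c∉ ∷ u) (a<b ∷ ordered) dj =
  (<⇒≢ a<b ∷ All.tabulate (not-elsewhere (inj₁ refl))) ∷ All.tabulate (not-elsewhere (inj₂ refl))
  ∷ disjoint⇒endpoints-unique C u ordered (λ p q → dj (there p) (there q))
  where
  not-elsewhere : ∀ {y} → IsEndpoint y (a , b) → ∀ {x} → x ∈ endpoints C → y ≢ x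
  not-elsewhere y∈c x∈ refl with ∈-endpoints⁻ C x∈
  ... | d , d∈ , y∈d = All.lookup c∉ d∈ (dj (here refl) (there d∈) y∈c y∈d)

∈-range1⁻ : ∀ {k x} → x ∈ range1 k → 1 ≤ x × x ≤ k
∈-range1⁻ q with ∈-map⁻ suc q
... | y , y∈ , refl = s≤s z≤n , ∈-upTo⁻ y∈

∈-range1⁺ : ∀ {k x} → 1 ≤ x → x ≤ k → x ∈ range1 k
∈-range1⁺ {x = suc y} _ x≤k = ∈-map⁺ suc (∈-upTo⁺ x≤k)

range1-unique : ∀ k → Unique (range1 k)
range1-unique k = Unique.map⁺ suc-injective (Unique.upTo⁺ k)

record IsDiagram (n : ℕ) (C : Diagram) : Set where
  field
    length≡  : length C ≡ n
    unique   : Unique C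
    src<snk  : ∀ {c} → c ∈ C → proj₁ c < proj₂ c
    1≤src    : ∀ {c} → c ∈ C → 1 ≤ proj₁ c
    snk≤2n   : ∀ {c} → c ∈ C → proj₂ c ≤ 2 * n
    covering : ∀ {x} → 1 ≤ x → x ≤ 2 * n → ∃ λ c → c ∈ C × IsEndpoint x c
    disjoint : EndpointDisjoint C

  endpoint-bounds : ∀ {c x} → c ∈ C → IsEndpoint x c → 1 ≤ x × x ≤ 2 * n
  endpoint-bounds c∈ (inj₁ refl) = 1≤src c∈ , <⇒≤ (<-≤-trans (src<snk c∈) (snk≤2n c∈))
  endpoint-bounds c∈ (inj₂ refl) = ≤-trans (1≤src c∈) (<⇒≤ (src<snk c∈)) , snk≤2n c∈

rooted⇒isDiagram : ∀ {C} → IsRootedChordDiagram C → IsDiagram (length C) C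
rooted⇒isDiagram {C} (_ , ordered , perm) = record
  { length≡  = refl
  ; unique   = endpoints-unique⇒unique C unique-endpoints
  ; src<snk  = All.lookup ordered
  ; 1≤src    = λ c∈ → proj₁ (bounds (∈-endpoints⁺ c∈ (inj₁ refl)))
  ; snk≤2n   = λ c∈ → proj₂ (bounds (∈-endpoints⁺ c∈ (inj₂ refl)))
  ; covering = λ 1≤x x≤2n → ∈-endpoints⁻ C (∈-resp-↭ (↭-sym perm) (∈-range1⁺ 1≤x x≤2n))
  ; disjoint = endpoints-unique⇒disjoint C unique-endpoints
  }
  where
  unique-endpoints = Unique-resp-↭ (↭-sym perm) (range1-unique _)
  bounds : ∀ {x} → x ∈ endpoints C → 1 ≤ x × x ≤ 2 * length C
  bounds q = ∈-range1⁻ (∈-resp-↭ perm q)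

isDiagram⇒rooted : ∀ {n C} → IsDiagram n C → 1 ≤ n → IsRootedChordDiagram C
isDiagram⇒rooted {n} {C} D 1≤n = nonempty , ordered , ⊆∧⊇⇒↭ _≟_ unique-endpoints (range1-unique _) to from
  where
  open IsDiagram D
  nonempty : C ≢ []
  nonempty refl = <⇒≢ 1≤n length≡
  ordered = All.tabulate src<snk
  unique-endpoints = disjoint⇒endpoints-unique C unique ordered disjoint
  to : endpoints C ⊆ range1 (2 * length C)
  to q with ∈-endpoints⁻ C q
  ... | c , c∈ , x∈c = subst (λ k → _ ∈ range1 (2 * k)) (sym length≡)
                             (uncurry ∈-range1⁺ (endpoint-bounds c∈ x∈c))
  from : range1 (2 * length C) ⊆ endpoints C
  from q with ∈-range1⁻ q
  ... | 1≤x , x≤2n with covering 1≤x (subst (λ k → _ ≤ 2 * k) length≡ x≤2n)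
  ... | c , c∈ , x∈c = ∈-endpoints⁺ c∈ x∈c

head-disjoint : ∀ {n c C} → IsDiagram n (c ∷ C) → ∀ {d x} → d ∈ C → IsEndpoint x d → IsEndpoint x c → ⊥
head-disjoint D d∈ x∈d x∈c with IsDiagram.disjoint D (here refl) (there d∈) x∈c x∈d | IsDiagram.unique D
... | refl | c∉ ∷ _ = All.lookup c∉ d∈ refl

isDiagram-↭ : ∀ {n C C′} → C ↭ C′ → IsDiagram n C → IsDiagram n C′
isDiagram-↭ {C′ = C′} p D = record
  { length≡  = trans (sym (↭-length p)) length≡
  ; unique   = Unique-resp-↭ p unique
  ; src<snk  = λ q → src<snk (back q)
  ; 1≤src    = λ q → 1≤src (back q)
  ; snk≤2n   = λ q → snk≤2n (back q)
  ; covering = λ 1≤x x≤2n → forth (covering 1≤x x≤2n)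
  ; disjoint = λ q r → disjoint (back q) (back r)
  }
  where
  open IsDiagram D
  back : C′ ⊆ _
  back = ∈-resp-↭ (↭-sym p)
  forth : ∀ {x} → (∃ λ c → c ∈ _ × IsEndpoint x c) → ∃ λ c → c ∈ C′ × IsEndpoint x c
  forth (c , c∈ , x∈c) = c , ∈-resp-↭ p c∈ , x∈c

greatest-source : ∀ {C : Diagram} {d} → d ∈ C → ∃ λ g → g ∈ C × (∀ {c} → c ∈ C → proj₁ c ≤ proj₁ g)
greatest-source {C} {d} d∈ = argmax proj₁ d C , g∈ , All.lookup (f[xs]≤f[argmax] d C)
  where
  g∈ : argmax proj₁ d C ∈ C
  g∈ with argmax-sel proj₁ d C
  ... | inj₁ g≡d = subst (_∈ C) (sym g≡d) d∈
  ... | inj₂ g∈C = g∈C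

source-maximal⇒terminal : ∀ {C c} → (∀ {d} → d ∈ C → proj₁ d ≤ proj₁ c) → Terminal C c
source-maximal⇒terminal maximal (d , d∈ , src<src , _) = <⇒≱ src<src (maximal d∈)

Terminal-resp-↭ : ∀ {C C′ c} → C ↭ C′ → Terminal C c → Terminal C′ c
Terminal-resp-↭ p terminal (d , d∈ , crossing) = terminal (d , ∈-resp-↭ (↭-sym p) d∈ , crossing)

root-chord : ∀ {n C} → IsDiagram n C → 1 ≤ n → ∃ λ K → (1 , K) ∈ C
root-chord D 1≤n with IsDiagram.covering D {1} ≤-refl (≤-trans 1≤n (m≤m+n _ _))
... | (a , b) , c∈ , inj₁ refl = b , c∈
... | (a , b) , c∈ , inj₂ refl = ⊥-elim (1+n≰n (≤-trans (s≤s (IsDiagram.1≤src D c∈)) (IsDiagram.src<snk D c∈)))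

greatest-source-≤ : ∀ {C : Diagram} {d} j → d ∈ C → proj₁ d ≤ j →
                    ∃ λ g → g ∈ C × proj₁ g ≤ j × (∀ {c} → c ∈ C → proj₁ c ≤ j → proj₁ c ≤ proj₁ g)
greatest-source-≤ j d∈ d≤j with greatest-source (∈-filter⁺ (λ c → proj₁ c ≤? j) d∈ d≤j)
... | g , g∈ , maximal with ∈-filter⁻ (λ c → proj₁ c ≤? j) g∈
...   | g∈C , g≤j = g , g∈C , g≤j , λ c∈ c≤j → maximal (∈-filter⁺ (λ c → proj₁ c ≤? j) c∈ c≤j)

mapChord : (ℕ → ℕ) → Chord → Chord
mapChord f c = (f (proj₁ c) , f (proj₂ c))

mapChord-injective : ∀ {f} → Injective _≡_ _≡_ f → Injective _≡_ _≡_ (mapChord f)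
mapChord-injective f-inj e = cong₂ _,_ (f-inj (cong proj₁ e)) (f-inj (cong proj₂ e))

IsEndpoint-mapChord⁻ : ∀ f {x c} → IsEndpoint x (mapChord f c) → ∃ λ y → IsEndpoint y c × x ≡ f y
IsEndpoint-mapChord⁻ f (inj₁ refl) = _ , inj₁ refl , refl
IsEndpoint-mapChord⁻ f (inj₂ refl) = _ , inj₂ refl , refl

IsEndpoint-mapChord⁺ : ∀ f {x c} → IsEndpoint x c → IsEndpoint (f x) (mapChord f c)
IsEndpoint-mapChord⁺ f (inj₁ refl) = inj₁ refl
IsEndpoint-mapChord⁺ f (inj₂ refl) = inj₂ refl

-- The relabelling f of the outer diagram in the definition of θ: it opens a gap of 2m places after j.
shiftOuter : ℕ → ℕ → ℕ → ℕ
shiftOuter j m p = if p ≤ᵇ j then suc p else p + 2 * m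

shiftOuter-≤ : ∀ j m {p} → p ≤ j → shiftOuter j m p ≡ suc p
shiftOuter-≤ j m {p} p≤j with p ≤ᵇ j in eq
... | true  = refl
... | false = ⊥-elim (<⇒≱ (≤ᵇ≡false⇒> _ _ eq) p≤j)

shiftOuter-> : ∀ j m {p} → j < p → shiftOuter j m p ≡ p + 2 * m
shiftOuter-> j m {p} j<p with p ≤ᵇ j in eq
... | true  = ⊥-elim (<⇒≱ j<p (≤ᵇ≡true⇒≤ _ _ eq))
... | false = refl

shiftOuter-mono : ∀ j {m} → 1 ≤ m → StrictlyMonotone (shiftOuter j m)
shiftOuter-mono j {m} 1≤m {p} {q} p<q with p ≤? j | q ≤? j
... | yes p≤j | yes q≤j rewrite shiftOuter-≤ j m p≤j | shiftOuter-≤ j m q≤j = s≤s p<q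
... | yes p≤j | no  q≰j rewrite shiftOuter-≤ j m p≤j | shiftOuter-> j m (≰⇒> q≰j) =
  ≤-trans (s≤s p<q) (subst (_≤ q + 2 * m) (+-comm q 1) (+-monoʳ-≤ q (≤-trans 1≤m (m≤m+n m (m + 0)))))
... | no  p≰j | yes q≤j = ⊥-elim (p≰j (≤-trans (<⇒≤ p<q) q≤j))
... | no  p≰j | no  q≰j rewrite shiftOuter-> j m (≰⇒> p≰j) | shiftOuter-> j m (≰⇒> q≰j) =
  +-monoˡ-< (2 * m) p<q

≤shiftOuter : ∀ j m p → p ≤ shiftOuter j m p
≤shiftOuter j m p with p ≤? j
... | yes p≤j rewrite shiftOuter-≤ j m p≤j       = n≤1+n p
... | no  p≰j rewrite shiftOuter-> j m (≰⇒> p≰j) = m≤m+n p (2 * m)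

shiftOuter≥2 : ∀ j {m p} → 1 ≤ m → 1 ≤ p → 2 ≤ shiftOuter j m p
shiftOuter≥2 j {m} {p} 1≤m 1≤p with p ≤? j
... | yes p≤j rewrite shiftOuter-≤ j m p≤j       = s≤s 1≤p
... | no  p≰j rewrite shiftOuter-> j m (≰⇒> p≰j) = +-mono-≤ 1≤p (≤-trans 1≤m (m≤m+n m (m + 0)))

1≤shiftOuter : ∀ j m p → 1 ≤ shiftOuter j m p
1≤shiftOuter j m p with p ≤? j
... | yes p≤j rewrite shiftOuter-≤ j m p≤j       = s≤s z≤n
... | no  p≰j rewrite shiftOuter-> j m (≰⇒> p≰j) = ≤-trans (s≤s z≤n) (≤-trans (≰⇒> p≰j) (m≤m+n p (2 * m)))

unshiftOuter : ℕ → ℕ → ℕ → ℕ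
unshiftOuter j m x = if x ≤ᵇ suc j then x ∸ 1 else x ∸ 2 * m

unshiftOuter-≤ : ∀ j m {x} → x ≤ suc j → unshiftOuter j m x ≡ x ∸ 1
unshiftOuter-≤ j m {x} x≤j+1 with x ≤ᵇ suc j in eq
... | true  = refl
... | false = ⊥-elim (<⇒≱ (≤ᵇ≡false⇒> _ _ eq) x≤j+1)

unshiftOuter-> : ∀ j m {x} → suc j < x → unshiftOuter j m x ≡ x ∸ 2 * m
unshiftOuter-> j m {x} j+1<x with x ≤ᵇ suc j in eq
... | true  = ⊥-elim (<⇒≱ j+1<x (≤ᵇ≡true⇒≤ _ _ eq))
... | false = refl

shiftOuter-unshiftOuter-≤ : ∀ j m {x} → 1 ≤ x → x ≤ suc j → shiftOuter j m (unshiftOuter j m x) ≡ x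
shiftOuter-unshiftOuter-≤ j m {suc x} _ x<j+1 rewrite unshiftOuter-≤ j m x<j+1 = shiftOuter-≤ j m (≤-pred x<j+1)

shiftOuter-unshiftOuter-> : ∀ j {m x} → 1 ≤ m → suc j + 2 * m ≤ x → shiftOuter j m (unshiftOuter j m x) ≡ x
shiftOuter-unshiftOuter-> j {m} {x} 1≤m j+2m<x = begin
  shiftOuter j m (unshiftOuter j m x)  ≡⟨ cong (shiftOuter j m) (unshiftOuter-> j m j+1<x) ⟩
  shiftOuter j m (x ∸ 2 * m)           ≡⟨ shiftOuter-> j m j<x-2m ⟩
  x ∸ 2 * m + 2 * m                    ≡⟨ m∸n+n≡m 2m≤x ⟩
  x                                    ∎
  where
  open ≡-Reasoning
  2m≤x : 2 * m ≤ x
  2m≤x = ≤-trans (m≤n+m (2 * m) (suc j)) j+2m<x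
  j+1<x : suc j < x
  j+1<x = ≤-trans (subst (_≤ suc j + 2 * m) (+-comm (suc j) 1)
                    (+-monoʳ-≤ (suc j) (≤-trans 1≤m (m≤m+n m (m + 0))))) j+2m<x
  j<x-2m : j < x ∸ 2 * m
  j<x-2m = +-cancelʳ-≤ (2 * m) (suc j) (x ∸ 2 * m) (subst (suc j + 2 * m ≤_) (sym (m∸n+n≡m 2m≤x)) j+2m<x)

-- Grafting diagrams

-- θ (graft τ' τ'' i) when θ τ' = (1 , k) ∷ T' and θ τ'' = C'', with j the paper's RTIP index.
graftDiagram : ℕ → ℕ → ℕ → Diagram → Diagram → Diagram
graftDiagram k j m T' C'' = (1 , k + j) ∷ map (mapChord (_+ j)) T' ++ map (mapChord (shiftOuter j m)) C''

∈-graftDiagram⁻ : ∀ {k j m T' C'' c} → c ∈ graftDiagram k j m T' C'' →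
                  c ≡ (1 , k + j)
                  ⊎ (∃ λ d → d ∈ T' × c ≡ mapChord (_+ j) d)
                  ⊎ (∃ λ d → d ∈ C'' × c ≡ mapChord (shiftOuter j m) d)
∈-graftDiagram⁻ (here refl) = inj₁ refl
∈-graftDiagram⁻ {j = j} {m} {T'} (there q) with ∈-++⁻ (map (mapChord (_+ j)) T') q
... | inj₁ q′ = inj₂ (inj₁ (∈-map⁻ (mapChord (_+ j)) q′))
... | inj₂ q′ = inj₂ (inj₂ (∈-map⁻ (mapChord (shiftOuter j m)) q′))

∈-graftDiagram-inner : ∀ {k j m T' C'' d} → d ∈ T' → mapChord (_+ j) d ∈ graftDiagram k j m T' C''
∈-graftDiagram-inner {j = j} d∈ = there (∈-++⁺ˡ (∈-map⁺ (mapChord (_+ j)) d∈))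

∈-graftDiagram-outer : ∀ {k j m T' C'' d} → d ∈ C'' →
                       mapChord (shiftOuter j m) d ∈ graftDiagram k j m T' C''
∈-graftDiagram-outer {j = j} {m} {T'} d∈ =
  there (∈-++⁺ʳ (map (mapChord (_+ j)) T') (∈-map⁺ (mapChord (shiftOuter j m)) d∈))

module GraftBounds {m n'' k j : ℕ} {T' C'' : Diagram}
                   (1≤m : 1 ≤ m) (2≤k : 2 ≤ k) (k≤2m : k ≤ 2 * m) (j<2n : suc j ≤ 2 * n'') where

  F : ℕ → ℕ
  F = shiftOuter j m

  F-mono : StrictlyMonotone F
  F-mono = shiftOuter-mono j 1≤m

  F-injective : Injective _≡_ _≡_ F
  F-injective = monotone⇒injective F-mono

  +j-injective : Injective _≡_ _≡_ (_+ j)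
  +j-injective {p} {q} = +-cancelʳ-≡ j p q

  2*[m+n]≡2*n+2*m : 2 * (m + n'') ≡ 2 * n'' + 2 * m
  2*[m+n]≡2*n+2*m = trans (*-distribˡ-+ 2 m n'') (+-comm (2 * m) (2 * n''))

  F≤2[m+n] : ∀ {p} → p ≤ 2 * n'' → F p ≤ 2 * (m + n'')
  F≤2[m+n] {p} p≤2n rewrite 2*[m+n]≡2*n+2*m with p ≤? j
  ... | yes p≤j rewrite shiftOuter-≤ j m p≤j       = ≤-trans (s≤s p≤j) (≤-trans j<2n (m≤m+n (2 * n'') (2 * m)))
  ... | no  p≰j rewrite shiftOuter-> j m (≰⇒> p≰j) = +-monoˡ-≤ (2 * m) p≤2n

  inner≢outer : ∀ {e p} → 2 ≤ e → e ≤ 2 * m → e + j ≢ F p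
  inner≢outer {e} {p} 2≤e e≤2m eq with p ≤? j
  ... | yes p≤j rewrite shiftOuter-≤ j m p≤j =
    1+n≰n (≤-trans (subst (suc (suc j) ≤_) eq (+-monoˡ-≤ j 2≤e)) (s≤s p≤j))
  ... | no  p≰j rewrite shiftOuter-> j m (≰⇒> p≰j) =
    1+n≰n (≤-trans (subst (suc j + 2 * m ≤_) (sym eq) (+-monoˡ-≤ (2 * m) (≰⇒> p≰j)))
                   (subst (_≤ j + 2 * m) (+-comm j e) (+-monoʳ-≤ j e≤2m)))

  1≢inner : ∀ {e} → 2 ≤ e → 1 ≢ e + j
  1≢inner {e} 2≤e eq = 1+n≰n (≤-trans (≤-trans 2≤e (m≤m+n e j)) (≤-reflexive (sym eq)))

  1≢outer : ∀ {p} → 1 ≤ p → 1 ≢ F p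
  1≢outer 1≤p eq = 1+n≰n (subst (2 ≤_) (sym eq) (shiftOuter≥2 j 1≤m 1≤p))

  rootSink≢outer : ∀ {p} → k + j ≢ F p
  rootSink≢outer {p} = inner≢outer {p = p} 2≤k k≤2m

  inner-chords outer-chords : Diagram
  inner-chords = map (mapChord (_+ j)) T'
  outer-chords = map (mapChord F) C''

  data GraftEndpoint (x : ℕ) : Chord → Set where
    root  : x ≡ 1 ⊎ x ≡ k + j → GraftEndpoint x (1 , k + j)
    inner : ∀ {d e} → d ∈ T' → IsEndpoint e d → x ≡ e + j → GraftEndpoint x (mapChord (_+ j) d)
    outer : ∀ {d p} → d ∈ C'' → IsEndpoint p d → x ≡ F p → GraftEndpoint x (mapChord F d)

  graft-endpoint : ∀ {c x} → c ∈ graftDiagram k j m T' C'' → IsEndpoint x c → GraftEndpoint x c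
  graft-endpoint c∈ x∈c with ∈-graftDiagram⁻ {k} {j} {m} {T'} {C''} c∈
  ... | inj₁ refl = root x∈c
  ... | inj₂ (inj₁ (d , d∈ , refl)) with IsEndpoint-mapChord⁻ (_+ j) x∈c
  ...   | e , e∈d , refl = inner d∈ e∈d refl
  graft-endpoint c∈ x∈c | inj₂ (inj₂ (d , d∈ , refl)) with IsEndpoint-mapChord⁻ F x∈c
  ...   | p , p∈d , refl = outer d∈ p∈d refl

module GraftIsDiagram {m n'' k j : ℕ} {T' C'' : Diagram}
                      (D' : IsDiagram m ((1 , k) ∷ T')) (D'' : IsDiagram n'' C'')
                      (j<2n : suc j ≤ 2 * n'') where

  1≤m : 1 ≤ m
  1≤m = subst (1 ≤_) (IsDiagram.length≡ D') (s≤s z≤n)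

  2≤k : 2 ≤ k
  2≤k = IsDiagram.src<snk D' (here refl)

  k≤2m : k ≤ 2 * m
  k≤2m = IsDiagram.snk≤2n D' (here refl)

  open GraftBounds {m} {n''} {k} {j} {T'} {C''} 1≤m 2≤k k≤2m j<2n public

  C : Diagram
  C = graftDiagram k j m T' C''

  inner-endpoint : ∀ {d e} → d ∈ T' → IsEndpoint e d → 2 ≤ e × e ≤ 2 * m × e ≢ k
  inner-endpoint d∈ e∈d with IsDiagram.endpoint-bounds D' (there d∈) e∈d
  ... | 1≤e , e≤2m = ≥1∧≢1⇒≥2 1≤e (λ e≡1 → head-disjoint D' d∈ e∈d (inj₁ e≡1)) , e≤2m ,
                     (λ e≡k → head-disjoint D' d∈ e∈d (inj₂ e≡k))

  outer-endpoint : ∀ {d p} → d ∈ C'' → IsEndpoint p d → 1 ≤ p × p ≤ 2 * n''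
  outer-endpoint = IsDiagram.endpoint-bounds D''

  unique-T' : Unique T'
  unique-T' = AllPairs.tail (IsDiagram.unique D')

  inner∉outer : ∀ {c} → c ∈ inner-chords → c ∉ outer-chords
  inner∉outer p q with ∈-map⁻ (mapChord (_+ j)) p | ∈-map⁻ (mapChord F) q
  ... | d , d∈ , refl | d′ , _ , e with inner-endpoint d∈ (inj₁ refl)
  ...   | 2≤e , e≤2m , _ = inner≢outer {p = proj₁ d′} 2≤e e≤2m (cong proj₁ e)

  root∉rest : ∀ {c} → c ∈ inner-chords ++ outer-chords → (1 , k + j) ≢ c
  root∉rest q e with ∈-++⁻ inner-chords q
  ... | inj₁ p with ∈-map⁻ (mapChord (_+ j)) p
  ...   | d , d∈ , refl = 1≢inner (proj₁ (inner-endpoint d∈ (inj₁ refl))) (cong proj₁ e)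
  root∉rest q e | inj₂ p with ∈-map⁻ (mapChord F) p
  ...   | d , d∈ , refl = 1≢outer (proj₁ (outer-endpoint d∈ (inj₁ refl))) (cong proj₁ e)

  unique-C : Unique C
  unique-C = All.tabulate root∉rest ∷
    Unique.++⁺ (Unique.map⁺ (mapChord-injective +j-injective) unique-T')
               (Unique.map⁺ (mapChord-injective F-injective) (IsDiagram.unique D''))
               (λ (p , q) → inner∉outer p q)

  length-C : length C ≡ m + n''
  length-C = begin
    suc (length (inner-chords ++ outer-chords))       ≡⟨ cong suc (length-++ inner-chords) ⟩
    suc (length inner-chords + length outer-chords)  ≡⟨ cong₂ (λ a b → suc (a + b))
                                                          (length-map (mapChord (_+ j)) T')
                                                          (length-map (mapChord F) C'') ⟩
    suc (length T' + length C'')                      ≡⟨ cong₂ _+_ (IsDiagram.length≡ D') (IsDiagram.length≡ D'') ⟩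
    m + n''                                           ∎
    where open ≡-Reasoning

  src<snk-C : ∀ {c} → c ∈ C → proj₁ c < proj₂ c
  src<snk-C c∈ with ∈-graftDiagram⁻ {k} {j} {m} {T'} {C''} c∈
  ... | inj₁ refl                   = ≤-trans 2≤k (m≤m+n k j)
  ... | inj₂ (inj₁ (d , d∈ , refl)) = +-monoˡ-< j (IsDiagram.src<snk D' (there d∈))
  ... | inj₂ (inj₂ (d , d∈ , refl)) = F-mono (IsDiagram.src<snk D'' d∈)

  1≤src-C : ∀ {c} → c ∈ C → 1 ≤ proj₁ c
  1≤src-C c∈ with ∈-graftDiagram⁻ {k} {j} {m} {T'} {C''} c∈
  ... | inj₁ refl                   = ≤-refl
  ... | inj₂ (inj₁ (d , d∈ , refl)) = ≤-trans (IsDiagram.1≤src D' (there d∈)) (m≤m+n _ j)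
  ... | inj₂ (inj₂ (d , d∈ , refl)) = ≤-trans (s≤s z≤n) (shiftOuter≥2 j 1≤m (IsDiagram.1≤src D'' d∈))

  e+j≤2[m+n] : ∀ {e} → e ≤ 2 * m → e + j ≤ 2 * (m + n'')
  e+j≤2[m+n] {e} e≤2m =
    subst (e + j ≤_) (sym (*-distribˡ-+ 2 m n'')) (+-mono-≤ e≤2m (≤-trans (n≤1+n j) j<2n))

  snk≤2n-C : ∀ {c} → c ∈ C → proj₂ c ≤ 2 * (m + n'')
  snk≤2n-C c∈ with ∈-graftDiagram⁻ {k} {j} {m} {T'} {C''} c∈
  ... | inj₁ refl                   = e+j≤2[m+n] k≤2m
  ... | inj₂ (inj₁ (d , d∈ , refl)) = e+j≤2[m+n] (IsDiagram.snk≤2n D' (there d∈))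
  ... | inj₂ (inj₂ (d , d∈ , refl)) = F≤2[m+n] (IsDiagram.snk≤2n D'' d∈)

  Covered : ℕ → Set
  Covered x = ∃ λ c → c ∈ C × IsEndpoint x c

  cover-outer : ∀ {x p} → 1 ≤ p → p ≤ 2 * n'' → F p ≡ x → Covered x
  cover-outer {p = p} 1≤p p≤2n refl with IsDiagram.covering D'' 1≤p p≤2n
  ... | d , d∈ , p∈d = mapChord F d , ∈-graftDiagram-outer {k} {j} {m} {T'} {C''} d∈ ,
                       IsEndpoint-mapChord⁺ F p∈d

  cover-inner : ∀ {e} → 2 ≤ e → e ≤ 2 * m → Covered (e + j)
  cover-inner 2≤e e≤2m with IsDiagram.covering D' (≤-trans (s≤s z≤n) 2≤e) e≤2m
  ... | _ , here refl , inj₁ refl = ⊥-elim (1+n≰n 2≤e)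
  ... | _ , here refl , inj₂ refl = (1 , k + j) , here refl , inj₂ refl
  ... | d , there d∈ , e∈d = mapChord (_+ j) d , ∈-graftDiagram-inner {k} {j} {m} {T'} {C''} d∈ ,
                             IsEndpoint-mapChord⁺ (_+ j) e∈d

  covering-C : ∀ {x} → 1 ≤ x → x ≤ 2 * (m + n'') → Covered x
  covering-C {x} 1≤x x≤2[m+n] with x ≤? 1 | x ≤? suc j | x ≤? j + 2 * m
  ... | yes x≤1 | _         | _       = (1 , k + j) , here refl , inj₁ (≤-antisym x≤1 1≤x)
  ... | no  x≰1 | yes x≤j+1 | _       with ≰⇒> x≰1
  ...   | s≤s 1≤x-1 = cover-outer 1≤x-1 (≤-trans (≤-pred x≤j+1) (≤-trans (n≤1+n j) j<2n))
                        (shiftOuter-≤ j m (≤-pred x≤j+1))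
  covering-C {x} 1≤x x≤2[m+n] | no _ | no x≰j+1 | yes x≤j+2m =
    subst Covered e+j≡x (cover-inner 2≤e e≤2m)
    where
    e = x ∸ j
    e+j≡x : e + j ≡ x
    e+j≡x = m∸n+n≡m (≤-trans (n≤1+n j) (<⇒≤ (≰⇒> x≰j+1)))
    2≤e : 2 ≤ e
    2≤e = +-cancelʳ-≤ j 2 e (subst (2 + j ≤_) (sym e+j≡x) (≰⇒> x≰j+1))
    e≤2m : e ≤ 2 * m
    e≤2m = +-cancelʳ-≤ j e (2 * m)
             (subst (_≤ 2 * m + j) (sym e+j≡x) (subst (x ≤_) (+-comm j (2 * m)) x≤j+2m))
  covering-C {x} 1≤x x≤2[m+n] | no _ | no _     | no x≰j+2m =
    cover-outer (≤-trans (s≤s z≤n) j<p) p≤2n (trans (shiftOuter-> j m j<p) p+2m≡x)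
    where
    p = x ∸ 2 * m
    p+2m≡x : p + 2 * m ≡ x
    p+2m≡x = m∸n+n≡m (≤-trans (m≤n+m (2 * m) j) (<⇒≤ (≰⇒> x≰j+2m)))
    j<p : j < p
    j<p = +-cancelʳ-< (2 * m) j p (subst (j + 2 * m <_) (sym p+2m≡x) (≰⇒> x≰j+2m))
    p≤2n : p ≤ 2 * n''
    p≤2n = +-cancelʳ-≤ (2 * m) p (2 * n'') (subst₂ _≤_ (sym p+2m≡x) 2*[m+n]≡2*n+2*m x≤2[m+n])

  root-determines-chord : ∀ {d x} → x ≡ 1 ⊎ x ≡ k + j → GraftEndpoint x d → (1 , k + j) ≡ d
  root-determines-chord _           (root _)            = refl
  root-determines-chord (inj₁ refl) (inner d∈ e∈d x≡) = ⊥-elim (1≢inner (proj₁ (inner-endpoint d∈ e∈d)) x≡)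
  root-determines-chord (inj₂ refl) (inner d∈ e∈d x≡) =
    ⊥-elim (proj₂ (proj₂ (inner-endpoint d∈ e∈d)) (sym (+j-injective x≡)))
  root-determines-chord (inj₁ refl) (outer {p = p} d∈ p∈d x≡) =
    ⊥-elim (1≢outer {p} (proj₁ (outer-endpoint d∈ p∈d)) x≡)
  root-determines-chord (inj₂ refl) (outer {p = p} _ _ x≡) = ⊥-elim (rootSink≢outer {p} x≡)

  inner≢outer-endpoint : ∀ {d e p} → d ∈ T' → IsEndpoint e d → e + j ≢ F p
  inner≢outer-endpoint {p = p} d∈ e∈d with inner-endpoint d∈ e∈d
  ... | 2≤e , e≤2m , _ = inner≢outer {p = p} 2≤e e≤2m

  endpoint-determines-chord : ∀ {c d x} → GraftEndpoint x c → GraftEndpoint x d → c ≡ d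
  endpoint-determines-chord (root r) d′ = root-determines-chord r d′
  endpoint-determines-chord c′ (root r) = sym (root-determines-chord r c′)
  endpoint-determines-chord (inner {d} d∈ e∈d refl) (inner {d′} d′∈ e′∈d′ x≡) =
    cong (mapChord (_+ j)) (IsDiagram.disjoint D' (there d∈) (there d′∈) e∈d
                              (subst (λ z → IsEndpoint z d′) (sym (+j-injective x≡)) e′∈d′))
  endpoint-determines-chord (inner d∈ e∈d refl) (outer {p = p} _ _ x≡) =
    ⊥-elim (inner≢outer-endpoint {p = p} d∈ e∈d x≡)
  endpoint-determines-chord (outer {p = p} _ _ refl) (inner d∈ e∈d x≡) =
    ⊥-elim (inner≢outer-endpoint {p = p} d∈ e∈d (sym x≡))
  endpoint-determines-chord (outer {d} d∈ p∈d refl) (outer {d′} d′∈ p′∈d′ x≡) =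
    cong (mapChord F) (IsDiagram.disjoint D'' d∈ d′∈ p∈d
                         (subst (λ z → IsEndpoint z d′) (sym (F-injective x≡)) p′∈d′))

  isDiagram : IsDiagram (m + n'') C
  isDiagram = record
    { length≡  = length-C
    ; unique   = unique-C
    ; src<snk  = src<snk-C
    ; 1≤src    = 1≤src-C
    ; snk≤2n   = snk≤2n-C
    ; covering = covering-C
    ; disjoint = λ c∈ d∈ x∈c x∈d →
        endpoint-determines-chord (graft-endpoint c∈ x∈c) (graft-endpoint d∈ x∈d)
    }

module GraftComponents {m n'' k j : ℕ} {T' C'' : Diagram}
                       (length-T' : suc (length T') ≡ m) (length-C'' : length C'' ≡ n'')
                       (2≤k : 2 ≤ k) (k≤2m : k ≤ 2 * m) (j<2n : suc j ≤ 2 * n'')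
                       (inner-bounds : ∀ {d e} → d ∈ T' → IsEndpoint e d → 2 ≤ e × e ≤ 2 * m)
                       (D : IsDiagram (m + n'') (graftDiagram k j m T' C'')) where

  1≤m : 1 ≤ m
  1≤m = subst (1 ≤_) length-T' (s≤s z≤n)

  open GraftBounds {m} {n''} {k} {j} {T'} {C''} 1≤m 2≤k k≤2m j<2n

  unique-rest : Unique (inner-chords ++ outer-chords)
  unique-rest = AllPairs.tail (IsDiagram.unique D)

  root∉rest : ∀ {c} → c ∈ inner-chords ++ outer-chords → (1 , k + j) ≢ c
  root∉rest with IsDiagram.unique D
  ... | root∉ ∷ _ = All.lookup root∉

  in-inner : ∀ {d} → d ∈ T' → mapChord (_+ j) d ∈ graftDiagram k j m T' C''
  in-inner = ∈-graftDiagram-inner {k} {j} {m} {T'} {C''}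

  in-outer : ∀ {d} → d ∈ C'' → mapChord F d ∈ graftDiagram k j m T' C''
  in-outer = ∈-graftDiagram-outer {k} {j} {m} {T'} {C''}

  outer-bounds : ∀ {d p} → d ∈ C'' → IsEndpoint p d → 1 ≤ p × p ≤ 2 * n''
  outer-bounds {d} {p} d∈ p∈d = n≢0⇒n>0 p≢0 , p≤2n
    where
    p≢0 : p ≢ 0
    p≢0 refl = root∉rest (∈-++⁺ʳ inner-chords (∈-map⁺ (mapChord F) d∈))
                 (IsDiagram.disjoint D (here refl) (in-outer d∈) (inj₁ refl) (IsEndpoint-mapChord⁺ F p∈d))
    p≤2n : p ≤ 2 * n''
    p≤2n with p ≤? j
    ... | yes p≤j = ≤-trans p≤j (≤-trans (n≤1+n j) j<2n)
    ... | no  p≰j = +-cancelʳ-≤ (2 * m) p (2 * n'')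
      (subst₂ _≤_ (shiftOuter-> j m (≰⇒> p≰j)) 2*[m+n]≡2*n+2*m
        (proj₂ (IsDiagram.endpoint-bounds D (in-outer d∈) (IsEndpoint-mapChord⁺ F p∈d))))

  outer-covering : ∀ {x} → 1 ≤ x → x ≤ 2 * n'' → ∃ λ c → c ∈ C'' × IsEndpoint x c
  outer-covering {x} 1≤x x≤2n with IsDiagram.covering D (≤-trans (s≤s z≤n) (shiftOuter≥2 j 1≤m 1≤x)) (F≤2[m+n] x≤2n)
  ... | c , c∈ , Fx∈c with graft-endpoint c∈ Fx∈c
  ...   | root (inj₁ Fx≡1)  = ⊥-elim (1≢outer {x} 1≤x (sym Fx≡1))
  ...   | root (inj₂ Fx≡kj) = ⊥-elim (rootSink≢outer {x} (sym Fx≡kj))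
  ...   | inner d∈ e∈d Fx≡ = ⊥-elim (inner≢outer {p = x} (proj₁ (inner-bounds d∈ e∈d)) (proj₂ (inner-bounds d∈ e∈d)) (sym Fx≡))
  ...   | outer {d} d∈ p∈d Fx≡ = d , d∈ , subst (λ z → IsEndpoint z d) (sym (F-injective Fx≡)) p∈d

  outer-isDiagram : IsDiagram n'' C''
  outer-isDiagram = record
    { length≡  = length-C''
    ; unique   = Unique.map⁻ (Unique-++⁻ʳ inner-chords unique-rest)
    ; src<snk  = λ c∈ → monotone-reflects-< F-mono (IsDiagram.src<snk D (in-outer c∈))
    ; 1≤src    = λ c∈ → proj₁ (outer-bounds c∈ (inj₁ refl))
    ; snk≤2n   = λ c∈ → proj₂ (outer-bounds c∈ (inj₂ refl))
    ; covering = outer-covering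
    ; disjoint = λ c∈ d∈ x∈c x∈d → mapChord-injective F-injective
        (IsDiagram.disjoint D (in-outer c∈) (in-outer d∈) (IsEndpoint-mapChord⁺ F x∈c) (IsEndpoint-mapChord⁺ F x∈d))
    }

  C' : Diagram
  C' = (1 , k) ∷ T'

  C'-endpoint-bounds : ∀ {c e} → c ∈ C' → IsEndpoint e c → 1 ≤ e × e ≤ 2 * m
  C'-endpoint-bounds (here refl) (inj₁ refl) = ≤-refl , ≤-trans (s≤s z≤n) (≤-trans 2≤k k≤2m)
  C'-endpoint-bounds (here refl) (inj₂ refl) = ≤-trans (s≤s z≤n) 2≤k , k≤2m
  C'-endpoint-bounds (there d∈)  e∈d         = ≤-trans (s≤s z≤n) (proj₁ (inner-bounds d∈ e∈d)) , proj₂ (inner-bounds d∈ e∈d)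

  inner-covering : ∀ {x} → 1 ≤ x → x ≤ 2 * m → ∃ λ c → c ∈ C' × IsEndpoint x c
  inner-covering {x} 1≤x x≤2m with x ≤? 1
  ... | yes x≤1 = (1 , k) , here refl , inj₁ (≤-antisym x≤1 1≤x)
  ... | no  x≰1 with IsDiagram.covering D {x + j} (≤-trans 1≤x (m≤m+n x j))
                       (≤-trans (+-mono-≤ x≤2m (≤-trans (n≤1+n j) j<2n)) (≤-reflexive (sym (*-distribˡ-+ 2 m n''))))
  ...   | c , c∈ , x+j∈c with graft-endpoint c∈ x+j∈c
  ...     | root (inj₁ x+j≡1)  = ⊥-elim (1≢inner (≰⇒> x≰1) (sym x+j≡1))
  ...     | root (inj₂ x+j≡kj) = (1 , k) , here refl , inj₂ (+j-injective x+j≡kj)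
  ...     | inner {d} d∈ e∈d x+j≡ = d , there d∈ , subst (λ z → IsEndpoint z d) (sym (+j-injective x+j≡)) e∈d
  ...     | outer {p = p} _ _ x+j≡ = ⊥-elim (inner≢outer {p = p} (≰⇒> x≰1) x≤2m x+j≡)

  root-sink∉inner : ∀ {d e} → d ∈ T' → IsEndpoint e d → k ≢ e
  root-sink∉inner d∈ e∈d refl = root∉rest (∈-++⁺ˡ (∈-map⁺ (mapChord (_+ j)) d∈))
    (IsDiagram.disjoint D (here refl) (in-inner d∈) (inj₂ refl) (IsEndpoint-mapChord⁺ (_+ j) e∈d))

  inner-disjoint : EndpointDisjoint C'
  inner-disjoint (here refl) (here refl) _ _ = refl
  inner-disjoint (here refl) (there d∈) (inj₁ refl) e∈d = ⊥-elim (1+n≰n (proj₁ (inner-bounds d∈ e∈d)))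
  inner-disjoint (here refl) (there d∈) (inj₂ refl) e∈d = ⊥-elim (root-sink∉inner d∈ e∈d refl)
  inner-disjoint (there d∈) (here refl) e∈d (inj₁ refl) = ⊥-elim (1+n≰n (proj₁ (inner-bounds d∈ e∈d)))
  inner-disjoint (there d∈) (here refl) e∈d (inj₂ refl) = ⊥-elim (root-sink∉inner d∈ e∈d refl)
  inner-disjoint (there c∈) (there d∈) x∈c x∈d = mapChord-injective +j-injective
    (IsDiagram.disjoint D (in-inner c∈) (in-inner d∈) (IsEndpoint-mapChord⁺ (_+ j) x∈c) (IsEndpoint-mapChord⁺ (_+ j) x∈d))

  inner-isDiagram : IsDiagram m C'
  inner-isDiagram = record
    { length≡  = length-T'
    ; unique   = All.tabulate (λ d∈ 1k≡d → 1+n≰n (subst (λ z → 2 ≤ proj₁ z) (sym 1k≡d) (proj₁ (inner-bounds d∈ (inj₁ refl)))))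
                 ∷ Unique.map⁻ (Unique-++⁻ˡ inner-chords unique-rest)
    ; src<snk  = λ { (here refl) → ≤-trans (s≤s (s≤s z≤n)) 2≤k
                   ; (there d∈)  → +-cancelʳ-< j _ _ (IsDiagram.src<snk D (in-inner d∈)) }
    ; 1≤src    = λ c∈ → proj₁ (C'-endpoint-bounds c∈ (inj₁ refl))
    ; snk≤2n   = λ c∈ → proj₂ (C'-endpoint-bounds c∈ (inj₂ refl))
    ; covering = inner-covering
    ; disjoint = inner-disjoint
    }

-- The map θ

rootSinkOf : ∀ {t} → Tubing t → ℕ
rootSinkOf τ = rootSink (θ τ)

nonRootOf : ∀ {t} → Tubing t → Diagram
nonRootOf τ = drop 1 (θ τ)

θ-head : ∀ {t} (τ : Tubing t) → θ τ ≡ (1 , rootSinkOf τ) ∷ nonRootOf τ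
θ-head vert             = refl
θ-head (graft τ' τ'' i) = refl

nonRootChords-id : ∀ (T : Diagram) → (∀ {c} → c ∈ T → proj₁ c ≢ 1) → nonRootChords T ≡ T
nonRootChords-id []                       _   = refl
nonRootChords-id ((zero , b) ∷ T)         src = cong ((zero , b) ∷_) (nonRootChords-id T (src ∘ there))
nonRootChords-id ((suc zero , b) ∷ T)     src = ⊥-elim (src (here refl) refl)
nonRootChords-id ((suc (suc a) , b) ∷ T)  src = cong ((suc (suc a) , b) ∷_) (nonRootChords-id T (src ∘ there))

θ-graft : ∀ {t' t''} (τ' : Tubing t') (τ'' : Tubing t'') (i : Fin (rtips t'')) →
          IsDiagram (size t') (θ τ') →
          θ (graft τ' τ'' i) ≡ graftDiagram (rootSinkOf τ') (suc (toℕ i)) (size t') (nonRootOf τ') (θ τ'')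
θ-graft τ' τ'' i D' =
  cong₂ (λ T m → (1 , rootSinkOf τ' + j) ∷ map (mapChord (_+ j)) T ++ map (mapChord (shiftOuter j m)) (θ τ''))
        (trans (cong nonRootChords (θ-head τ')) (nonRootChords-id (nonRootOf τ') src≢1))
        (IsDiagram.length≡ D')
  where
  j = suc (toℕ i)
  src≢1 : ∀ {c} → c ∈ nonRootOf τ' → proj₁ c ≢ 1
  src≢1 c∈ src≡1 = head-disjoint (subst (IsDiagram _) (θ-head τ') D') c∈ (inj₁ (sym src≡1)) (inj₁ refl)

θ-vert-isDiagram : IsDiagram 1 (θ vert)
θ-vert-isDiagram = record
  { length≡  = refl
  ; unique   = [] ∷ []
  ; src<snk  = λ { (here refl) → s≤s (s≤s z≤n) }
  ; 1≤src    = λ { (here refl) → s≤s z≤n }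
  ; snk≤2n   = λ { (here refl) → s≤s (s≤s z≤n) }
  ; covering = covering
  ; disjoint = λ { (here refl) (here refl) _ _ → refl }
  }
  where
  covering : ∀ {x} → 1 ≤ x → x ≤ 2 → ∃ λ c → c ∈ θ vert × IsEndpoint x c
  covering {suc zero}          _ _ = _ , here refl , inj₁ refl
  covering {suc (suc zero)}    _ _ = _ , here refl , inj₂ refl
  covering {suc (suc (suc _))} _ (s≤s (s≤s ()))

suc-RTIP<2*size : ∀ {t} (i : Fin (rtips t)) → suc (suc (toℕ i)) ≤ 2 * size t
suc-RTIP<2*size {t} i = subst (suc (suc (toℕ i)) ≤_) (suc-rtips≡2*size t) (s≤s (toℕ<n i))

size-graft : ∀ {t' t''} (i : Fin (rtips t'')) → size t' + size t'' ≡ size (insert t'' (toℕ i) t')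
size-graft {t'} {t''} i = trans (+-comm (size t') (size t'')) (sym (size-insert t'' (toℕ i) t' (toℕ<n i)))

θ-isDiagram : ∀ {t} (τ : Tubing t) → IsDiagram (size t) (θ τ)
θ-isDiagram vert = θ-vert-isDiagram
θ-isDiagram (graft {t'} {t''} τ' τ'' i) =
  subst₂ IsDiagram (size-graft i) (sym (θ-graft τ' τ'' i D'))
    (GraftIsDiagram.isDiagram (subst (IsDiagram (size t')) (θ-head τ') D') (θ-isDiagram τ'') (suc-RTIP<2*size i))
  where D' = θ-isDiagram τ'

leaf-tubing-unique : ∀ {t} (τ : Tubing t) → t ≡ node [] → _≡_ {A = Σ PTree Tubing} (t , τ) (node [] , vert)
leaf-tubing-unique vert _ = refl
leaf-tubing-unique (graft {t'} {t''} τ' τ'' i) e = ⊥-elim (insert≢leaf t'' (toℕ i) t' (toℕ<n i) e)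

graft-cong : ∀ {t' t''} (τ' : Tubing t') (τ'' : Tubing t'') {i₁ i₂ : Fin (rtips t'')} → toℕ i₁ ≡ toℕ i₂ →
             _≡_ {A = Σ PTree Tubing} (_ , graft τ' τ'' i₁) (_ , graft τ' τ'' i₂)
graft-cong τ' τ'' i₁≡i₂ with toℕ-injective i₁≡i₂
... | refl = refl

2≤length-θ-graft : ∀ {t' t''} (τ' : Tubing t') (τ'' : Tubing t'') (i : Fin (rtips t'')) →
                   2 ≤ length (θ (graft τ' τ'' i))
2≤length-θ-graft {t'} {t''} τ' τ'' i =
  subst (2 ≤_) (sym (trans (IsDiagram.length≡ (θ-isDiagram (graft τ' τ'' i))) (sym (size-graft i))))
    (+-mono-≤ (1≤size t') (1≤size t''))

θ-vert≭θ-graft : ∀ {t' t''} (τ' : Tubing t') (τ'' : Tubing t'') (i : Fin (rtips t'')) →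
                 ¬ (θ vert ↭ θ (graft τ' τ'' i))
θ-vert≭θ-graft τ' τ'' i p = 1+n≰n (subst (2 ≤_) (sym (↭-length p)) (2≤length-θ-graft τ' τ'' i))

θ-vert-↭ : ∀ {C} → IsDiagram 1 C → θ vert ↭ C
θ-vert-↭ {C} D = ⊆∧⊇⇒↭ _≟ᶜ_ ([] ∷ []) (IsDiagram.unique D) to from
  where
  only-chord : ∀ {a b} → 1 ≤ a → a < b → b ≤ 2 → (a , b) ≡ (1 , 2)
  only-chord 1≤a a<b b≤2 =
    cong₂ _,_ (≤-antisym (≤-pred (≤-trans a<b b≤2)) 1≤a) (≤-antisym b≤2 (≤-trans (s≤s 1≤a) a<b))
  is-only : ∀ {c} → c ∈ C → c ≡ (1 , 2)
  is-only c∈ = only-chord (IsDiagram.1≤src D c∈) (IsDiagram.src<snk D c∈) (IsDiagram.snk≤2n D c∈)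
  to : θ vert ⊆ C
  to (here refl) with root-chord D ≤-refl
  ... | K , r∈ = subst (_∈ C) (is-only r∈) r∈
  from : C ⊆ θ vert
  from c∈ = here (is-only c∈)

-- Leaf tubings and 1-terminal diagrams

leafSplit⇒leaf : ∀ {t' t''} {i : Fin (rtips t'')} → LeafSplit t' t'' i → t' ≡ node []
leafSplit⇒leaf (inj₁ t'≡leaf) = t'≡leaf
leafSplit⇒leaf {t'} {node ts} {i} (inj₂ (_ , no-children)) =
  ⊥-elim (insertL≢[] ts (toℕ i) t' (≤-pred (toℕ<n i)) no-children)

leafGraft : ℕ → Diagram → Diagram
leafGraft j D = (1 , 2 + j) ∷ map (mapChord (shiftOuter j 1)) D

module LeafGraftTerminal (j : ℕ) where

  F : ℕ → ℕ
  F = shiftOuter j 1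

  F-mono : StrictlyMonotone F
  F-mono = shiftOuter-mono j {1} (s≤s z≤n)

  terminal-leafGraft⁺ : ∀ {D d} → Terminal D d → Terminal (leafGraft j D) (mapChord F d)
  terminal-leafGraft⁺ {d = d} _ (_ , here refl , F[a]<1 , _) = 1+n≰n (≤-trans F[a]<1 (1≤shiftOuter j 1 (proj₁ d)))
  terminal-leafGraft⁺ terminal (_ , there q , a<a′ , a′<b , b<b′) with ∈-map⁻ (mapChord F) q
  ... | e , e∈ , refl = terminal (e , e∈ , monotone-reflects-< F-mono a<a′ ,
                                  monotone-reflects-< F-mono a′<b , monotone-reflects-< F-mono b<b′)

  terminal-leafGraft⁻ : ∀ {D d} → Terminal (leafGraft j D) (mapChord F d) → Terminal D d
  terminal-leafGraft⁻ terminal (e , e∈ , a<a′ , a′<b , b<b′) =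
    terminal (mapChord F e , there (∈-map⁺ (mapChord F) e∈) , F-mono a<a′ , F-mono a′<b , F-mono b<b′)

  root-terminal⇒closed : ∀ {n'' D d} → IsDiagram n'' D → Terminal (leafGraft j D) (1 , 2 + j) →
                         d ∈ D → proj₁ d ≤ j → proj₂ d ≤ j
  root-terminal⇒closed {d = d} D root-terminal d∈ a≤j with proj₂ d ≤? j
  ... | yes b≤j = b≤j
  ... | no  b≰j = ⊥-elim (root-terminal (mapChord F d , there (∈-map⁺ (mapChord F) d∈) ,
          subst (1 <_) (sym (shiftOuter-≤ j 1 a≤j)) (s≤s (IsDiagram.1≤src D d∈)) ,
          subst (_< 2 + j) (sym (shiftOuter-≤ j 1 a≤j)) (s≤s (s≤s a≤j)) ,
          subst (2 + j <_) (sym (shiftOuter-> j 1 (≰⇒> b≰j)))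
            (subst (_≤ proj₂ d + 2) (+-comm (suc j) 2) (+-monoˡ-≤ 2 (≰⇒> b≰j)))))

  -- Otherwise the chord with the greatest source ≤ j and the chord with the greatest source
  -- overall (which lies beyond j) would be two different terminal chords of D.
  root-not-terminal : ∀ {n'' D} → IsDiagram n'' D → OneTerminal D → 1 ≤ j → suc j ≤ 2 * n'' →
                      ¬ Terminal (leafGraft j D) (1 , 2 + j)
  root-not-terminal {n''} {D} D′ (_ , _ , _ , only-terminal) 1≤j j<2n root-terminal =
    <⇒≱ (≤-<-trans c≤j j<e) (subst (λ z → proj₁ e ≤ proj₁ z) (sym c≡g) (g-maximal e∈))
    where
    closed : ∀ {d} → d ∈ D → proj₁ d ≤ j → proj₂ d ≤ j
    closed = root-terminal⇒closed D′ root-terminal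
    chord-at-1 = IsDiagram.covering D′ {1} ≤-refl (≤-trans (s≤s z≤n) j<2n)
    1∈d : IsEndpoint 1 (proj₁ chord-at-1)
    1∈d = proj₂ (proj₂ chord-at-1)
    src≤j : proj₁ (proj₁ chord-at-1) ≤ j
    src≤j with 1∈d
    ... | inj₁ 1≡a = subst (_≤ j) 1≡a 1≤j
    ... | inj₂ 1≡b = ⊥-elim (1+n≰n (≤-trans (s≤s (IsDiagram.1≤src D′ (proj₁ (proj₂ chord-at-1))))
                                     (≤-trans (IsDiagram.src<snk D′ (proj₁ (proj₂ chord-at-1))) (≤-reflexive (sym 1≡b)))))
    below = greatest-source-≤ j (proj₁ (proj₂ chord-at-1)) src≤j
    c = proj₁ below
    c∈ = proj₁ (proj₂ below)
    c≤j = proj₁ (proj₂ (proj₂ below))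
    c-terminal : Terminal D c
    c-terminal (d , d∈ , c<d , d<c , _) =
      <⇒≱ c<d (proj₂ (proj₂ (proj₂ below)) d∈ (<⇒≤ (<-≤-trans d<c (closed c∈ c≤j))))
    chord-at-j+1 = IsDiagram.covering D′ {suc j} (s≤s z≤n) j<2n
    e = proj₁ chord-at-j+1
    e∈ = proj₁ (proj₂ chord-at-j+1)
    j<e : j < proj₁ e
    j<e with proj₁ e ≤? j | proj₂ (proj₂ chord-at-j+1)
    ... | no  e≰j | _         = ≰⇒> e≰j
    ... | yes e≤j | inj₁ j+1≡ = ⊥-elim (1+n≰n (subst (_≤ j) (sym j+1≡) e≤j))
    ... | yes e≤j | inj₂ j+1≡ = ⊥-elim (1+n≰n (subst (_≤ j) (sym j+1≡) (closed e∈ e≤j)))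
    overall = greatest-source e∈
    g = proj₁ overall
    g-maximal = proj₂ (proj₂ overall)
    c≡g : c ≡ g
    c≡g = trans (only-terminal c c∈ c-terminal)
                (sym (only-terminal g (proj₁ (proj₂ overall)) (source-maximal⇒terminal g-maximal)))

  leafGraft-oneTerminal : ∀ {n'' D} → IsDiagram n'' D → OneTerminal D → 1 ≤ j → suc j ≤ 2 * n'' →
                          OneTerminal (leafGraft j D)
  leafGraft-oneTerminal {D = D} D′ one@(c₀ , c₀∈ , c₀-terminal , only-terminal) 1≤j j<2n =
    mapChord F c₀ , there (∈-map⁺ (mapChord F) c₀∈) , terminal-leafGraft⁺ c₀-terminal , only
    where
    only : ∀ d → d ∈ leafGraft j D → Terminal (leafGraft j D) d → d ≡ mapChord F c₀
    only d (here refl) d-terminal = ⊥-elim (root-not-terminal D′ one 1≤j j<2n d-terminal)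
    only d (there q)   d-terminal with ∈-map⁻ (mapChord F) q
    ... | d′ , d′∈ , refl = cong (mapChord F) (only-terminal d′ d′∈ (terminal-leafGraft⁻ d-terminal))

θ-oneTerminal : ∀ {t} {τ : Tubing t} → IsLeafTubing τ → OneTerminal (θ τ)
θ-oneTerminal vert = (1 , 2) , here refl , (λ { (_ , here refl , s≤s () , _) }) , λ { d (here refl) _ → refl }
θ-oneTerminal (graft {t''} {τ' = τ'} {τ''} {i} split _ leaf'') with leaf-tubing-unique τ' (leafSplit⇒leaf split)
... | refl = LeafGraftTerminal.leafGraft-oneTerminal (suc (toℕ i)) (θ-isDiagram τ'') (θ-oneTerminal leaf'')
               (s≤s z≤n) (suc-RTIP<2*size i)

leafGraft-position-injective : ∀ {j₁ j₂ n D₁ D₂} → IsDiagram n D₂ →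
                               leafGraft j₁ D₁ ↭ leafGraft j₂ D₂ → j₁ ≡ j₂
leafGraft-position-injective {j₂ = j₂} D p with ∈-resp-↭ p (here refl)
... | here e = +-cancelˡ-≡ 2 _ _ (cong proj₂ e)
... | there q with ∈-map⁻ (mapChord (shiftOuter j₂ 1)) q
...   | d , d∈ , e = ⊥-elim (1+n≰n (subst (2 ≤_) (sym (cong proj₁ e))
                                      (shiftOuter≥2 j₂ {1} (s≤s z≤n) (IsDiagram.1≤src D d∈))))

θ-leafGraft-injective : ∀ {t₁ t₂} (τ₁ : Tubing t₁) (τ₂ : Tubing t₂) {i₁ i₂} → IsLeafTubing τ₁ → IsLeafTubing τ₂ →
                        θ (graft vert τ₁ i₁) ↭ θ (graft vert τ₂ i₂) →
                        _≡_ {A = Σ PTree Tubing} (_ , graft vert τ₁ i₁) (_ , graft vert τ₂ i₂)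

θ-leaf-injective : ∀ {t₁ t₂} (τ₁ : Tubing t₁) (τ₂ : Tubing t₂) → IsLeafTubing τ₁ → IsLeafTubing τ₂ →
                   θ τ₁ ↭ θ τ₂ → _≡_ {A = Σ PTree Tubing} (t₁ , τ₁) (t₂ , τ₂)
θ-leaf-injective vert vert _ _ _ = refl
θ-leaf-injective vert (graft τ' τ'' i) _ _ p = ⊥-elim (θ-vert≭θ-graft τ' τ'' i p)
θ-leaf-injective (graft τ' τ'' i) vert _ _ p = ⊥-elim (θ-vert≭θ-graft τ' τ'' i (↭-sym p))
θ-leaf-injective (graft τ'₁ τ''₁ i₁) (graft τ'₂ τ''₂ i₂) (graft split₁ _ leaf₁) (graft split₂ _ leaf₂) p
  with leaf-tubing-unique τ'₁ (leafSplit⇒leaf split₁) | leaf-tubing-unique τ'₂ (leafSplit⇒leaf split₂)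
... | refl | refl = θ-leafGraft-injective τ''₁ τ''₂ leaf₁ leaf₂ p

θ-leafGraft-injective τ₁ τ₂ {i₁} {i₂} leaf₁ leaf₂ p = same-graft (θ-leaf-injective τ₁ τ₂ leaf₁ leaf₂ θτ₁↭θτ₂)
  where
  j₁ = suc (toℕ i₁)
  j₂ = suc (toℕ i₂)
  j₁≡j₂ : j₁ ≡ j₂
  j₁≡j₂ = leafGraft-position-injective {j₁} {j₂} {D₁ = θ τ₁} (θ-isDiagram τ₂) p
  θτ₁↭θτ₂ : θ τ₁ ↭ θ τ₂
  θτ₁↭θτ₂ = map-↭⁻ _≟ᶜ_ (mapChord (shiftOuter j₁ 1))
    (mapChord-injective (monotone⇒injective (shiftOuter-mono j₁ {1} (s≤s z≤n))))
    (IsDiagram.unique (θ-isDiagram τ₁)) (IsDiagram.unique (θ-isDiagram τ₂))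
    (drop-∷ (subst (λ j → leafGraft j₁ (θ τ₁) ↭ leafGraft j (θ τ₂)) (sym j₁≡j₂) p))
  same-graft : _≡_ {A = Σ PTree Tubing} (_ , τ₁) (_ , τ₂) →
               _≡_ {A = Σ PTree Tubing} (_ , graft vert τ₁ i₁) (_ , graft vert τ₂ i₂)
  same-graft refl = graft-cong vert τ₁ (suc-injective j₁≡j₂)

shiftOuter-unshiftOuter-leaf : ∀ j {x} → 1 ≤ x → x ≢ 2 + j → shiftOuter j 1 (unshiftOuter j 1 x) ≡ x
shiftOuter-unshiftOuter-leaf j {x} 1≤x x≢j+2 with x ≤? suc j
... | yes x≤j+1 = shiftOuter-unshiftOuter-≤ j 1 1≤x x≤j+1
... | no  x≰j+1 = shiftOuter-unshiftOuter-> j ≤-refl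
  (subst (_≤ x) (+-comm 2 (suc j)) (≤∧≢⇒< (≰⇒> x≰j+1) (x≢j+2 ∘ sym)))

LeafPreimage : Diagram → Set
LeafPreimage C = Σ PTree λ t → Σ (Tubing t) λ τ → IsLeafTubing τ × (θ τ ↭ C)

module LeafDecomposition {n'' : ℕ} {C : Diagram} (D : IsDiagram (suc (suc n'')) C)
                         (one : OneTerminal C) where

  N : ℕ
  N = suc (suc n'')

  K : ℕ
  K = proj₁ (root-chord D (s≤s z≤n))

  root∈ : (1 , K) ∈ C
  root∈ = proj₂ (root-chord D (s≤s z≤n))

  around-root : ∃ λ xs → ∃ λ ys → C ≡ xs ++ (1 , K) ∷ ys
  around-root = ∈-∃++ root∈

  R : Diagram
  R = proj₁ around-root ++ proj₁ (proj₂ around-root)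

  C↭root∷R : C ↭ (1 , K) ∷ R
  C↭root∷R = subst (_↭ (1 , K) ∷ R) (sym (proj₂ (proj₂ around-root)))
                   (shift (1 , K) (proj₁ around-root) (proj₁ (proj₂ around-root)))

  D-R : IsDiagram N ((1 , K) ∷ R)
  D-R = isDiagram-↭ C↭root∷R D

  R-endpoint : ∀ {c x} → c ∈ R → IsEndpoint x c → 2 ≤ x × x ≢ K
  R-endpoint c∈ x∈c = ≥1∧≢1⇒≥2 (proj₁ (IsDiagram.endpoint-bounds D-R (there c∈) x∈c))
                                (λ x≡1 → head-disjoint D-R c∈ x∈c (inj₁ x≡1)) ,
                      (λ x≡K → head-disjoint D-R c∈ x∈c (inj₂ x≡K))

  some-chord : ∃ λ e → e ∈ R
  some-chord with R | IsDiagram.length≡ D-R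
  ... | e ∷ _ | _ = e , here refl

  -- The chord of greatest source is terminal, and it is not the root since R is nonempty.
  root-not-terminal : ¬ Terminal C (1 , K)
  root-not-terminal root-terminal =
    1+n≰n (≤-trans (proj₁ (R-endpoint e∈R (inj₁ refl))) (subst (λ g → proj₁ e ≤ proj₁ g) g≡root (maximal e∈C)))
    where
    e = proj₁ some-chord
    e∈R = proj₂ some-chord
    e∈C = ∈-resp-↭ (↭-sym C↭root∷R) (there e∈R)
    overall = greatest-source root∈
    maximal = proj₂ (proj₂ overall)
    only-terminal = proj₂ (proj₂ (proj₂ one))
    g≡root : proj₁ overall ≡ (1 , K)
    g≡root = trans (only-terminal _ (proj₁ (proj₂ overall)) (source-maximal⇒terminal maximal))
                   (sym (only-terminal _ root∈ root-terminal))

  3≤K : 3 ≤ K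
  3≤K = ≤∧≢⇒< (IsDiagram.src<snk D root∈) λ 2≡K → root-not-terminal
    λ (d , _ , 1<a , a<K , _) → 1+n≰n (≤-trans (s≤s 1<a) (subst (proj₁ d <_) (sym 2≡K) a<K))

  K<2N : K < 2 * N
  K<2N = ≤∧≢⇒< (IsDiagram.snk≤2n D root∈) λ K≡2N → root-not-terminal
    λ (d , d∈ , _ , _ , K<b) → 1+n≰n (≤-trans (subst (_< proj₂ d) K≡2N K<b) (IsDiagram.snk≤2n D d∈))

  j′ : ℕ
  j′ = proj₁ (m≤n⇒∃[o]m+o≡n 3≤K)

  j : ℕ
  j = suc j′

  K≡2+j : K ≡ 2 + j
  K≡2+j = sym (proj₂ (m≤n⇒∃[o]m+o≡n 3≤K))

  j<2n : suc j ≤ 2 * suc n''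
  j<2n = ≤-pred (≤-pred (subst₂ _≤_ (cong suc K≡2+j) (cong suc (+-suc (suc n'') (suc n'' + 0))) K<2N))

  C'' : Diagram
  C'' = map (mapChord (unshiftOuter j 1)) R

  shift-unshift : ∀ {c} → c ∈ R → mapChord (shiftOuter j 1) (mapChord (unshiftOuter j 1) c) ≡ c
  shift-unshift c∈ = cong₂ _,_ (restore (inj₁ refl)) (restore (inj₂ refl))
    where
    restore : ∀ {x} → IsEndpoint x _ → shiftOuter j 1 (unshiftOuter j 1 x) ≡ x
    restore x∈c with R-endpoint c∈ x∈c
    ... | 2≤x , x≢K = shiftOuter-unshiftOuter-leaf j (≤-trans (s≤s z≤n) 2≤x) (x≢K ∘ flip trans (sym K≡2+j))

  leafGraft↭C : leafGraft j C'' ↭ C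
  leafGraft↭C = subst (_↭ C) (sym leafGraft≡) (↭-sym C↭root∷R)
    where
    leafGraft≡ : leafGraft j C'' ≡ (1 , K) ∷ R
    leafGraft≡ = cong₂ _∷_ (cong (1 ,_) (sym K≡2+j))
      (trans (sym (map-∘ R)) (map-id-local (All.tabulate shift-unshift)))

  D'' : IsDiagram (suc n'') C''
  D'' = GraftComponents.outer-isDiagram {T' = []} refl
    (trans (length-map _ R) (suc-injective (IsDiagram.length≡ D-R)))
    ≤-refl ≤-refl j<2n (λ ()) (isDiagram-↭ (↭-sym leafGraft↭C) D)

  one'' : OneTerminal C''
  one'' = mapChord (unshiftOuter j 1) c₀ , ∈-map⁺ _ c₀∈R , terminal'' , only
    where
    open LeafGraftTerminal j using (F; terminal-leafGraft⁺; terminal-leafGraft⁻)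
    c₀ = proj₁ one
    c₀∈R : c₀ ∈ R
    c₀∈R with ∈-resp-↭ C↭root∷R (proj₁ (proj₂ one))
    ... | here refl = ⊥-elim (root-not-terminal (proj₁ (proj₂ (proj₂ one))))
    ... | there q   = q
    terminal'' : Terminal C'' (mapChord (unshiftOuter j 1) c₀)
    terminal'' = terminal-leafGraft⁻ (subst (Terminal (leafGraft j C'')) (sym (shift-unshift c₀∈R))
                     (Terminal-resp-↭ (↭-sym leafGraft↭C) (proj₁ (proj₂ (proj₂ one)))))
    only : ∀ d → d ∈ C'' → Terminal C'' d → d ≡ mapChord (unshiftOuter j 1) c₀
    only d d∈ d-terminal with ∈-map⁻ (mapChord (unshiftOuter j 1)) d∈
    ... | e , e∈ , refl = cong (mapChord (unshiftOuter j 1)) (trans (sym (shift-unshift e∈))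
          (proj₂ (proj₂ (proj₂ one)) _ (∈-resp-↭ leafGraft↭C (there (∈-map⁺ (mapChord F) d∈)))
             (Terminal-resp-↭ leafGraft↭C (terminal-leafGraft⁺ d-terminal))))

  preimage : LeafPreimage C'' → LeafPreimage C
  preimage (t'' , τ'' , leaf'' , θτ''↭C'') =
    _ , graft vert τ'' i , graft (inj₁ refl) vert leaf'' ,
    subst (_↭ C) (sym θ≡) (↭-trans (prep _ (map⁺ (mapChord (shiftOuter j 1)) θτ''↭C'')) leafGraft↭C)
    where
    size≡ : size t'' ≡ suc n''
    size≡ = trans (sym (IsDiagram.length≡ (θ-isDiagram τ''))) (trans (↭-length θτ''↭C'') (IsDiagram.length≡ D''))
    j′<rtips : j′ < rtips t''
    j′<rtips = ≤-pred (subst (suc j ≤_) (trans (cong (2 *_) (sym size≡)) (sym (suc-rtips≡2*size t''))) j<2n)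
    i : Fin (rtips t'')
    i = fromℕ< j′<rtips
    θ≡ : θ (graft vert τ'' i) ≡ leafGraft j (θ τ'')
    θ≡ = cong (λ z → leafGraft (suc z) (θ τ'')) (toℕ-fromℕ< j′<rtips)

θ-leaf-surjective : ∀ n {C} → IsDiagram (suc n) C → OneTerminal C → LeafPreimage C
θ-leaf-surjective zero      D _   = node [] , vert , vert , θ-vert-↭ D
θ-leaf-surjective (suc n'') D one = preimage (θ-leaf-surjective n'' D'' one'')
  where open LeafDecomposition D one

-- Ladders and connected 213-avoiding permutation diagrams

-- A permutation diagram of size n, in the form used below: its sources are exactly 1, …, n.
SplitAt : ℕ → Diagram → Set
SplitAt n C = ∀ {c} → c ∈ C → proj₁ c ≤ n × n < proj₂ c

Crosses-sym : ∀ {c d} → Crosses c d → Crosses d c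
Crosses-sym (inj₁ x) = inj₂ x
Crosses-sym (inj₂ x) = inj₁ x

full-root⇒connected : ∀ {n C} → IsDiagram n C → SplitAt n C → (1 , suc n) ∈ C → Connected C
full-root⇒connected {n} {C} D split root∈ c∈ d∈ = to-root c∈ ◅◅ from-root d∈
  where
  root = (1 , suc n)
  crosses-root : ∀ {e} → e ∈ C → e ≢ root → Crosses root e
  crosses-root {a , b} e∈ e≢root = inj₁ (1<a , s≤s (proj₁ (split e∈)) , n+1<b)
    where
    1<a : 1 < a
    1<a = ≥1∧≢1⇒≥2 (IsDiagram.1≤src D e∈) (λ a≡1 → e≢root (IsDiagram.disjoint D e∈ root∈ (inj₁ refl) (inj₁ a≡1)))
    n+1<b : suc n < b
    n+1<b = ≤∧≢⇒< (proj₂ (split e∈)) (λ n+1≡b → e≢root (IsDiagram.disjoint D e∈ root∈ (inj₂ refl) (inj₂ (sym n+1≡b))))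
  from-root : ∀ {e} → e ∈ C → Star (CrossIn C) root e
  from-root {e} e∈ with e ≟ᶜ root
  ... | yes refl   = ε
  ... | no  e≢root = (root∈ , e∈ , crosses-root e∈ e≢root) ◅ ε
  to-root : ∀ {e} → e ∈ C → Star (CrossIn C) e root
  to-root {e} e∈ with e ≟ᶜ root
  ... | yes refl   = ε
  ... | no  e≢root = (e∈ , root∈ , Crosses-sym (crosses-root e∈ e≢root)) ◅ ε

-- The sources form an initial segment 1, …, s of the points, and there are n of them.
permutation⇒splitAt : ∀ {n C} → IsDiagram n C → IsPermutationDiagram C → 1 ≤ n → SplitAt n C
permutation⇒splitAt {n} {C} D permutation 1≤n {c} c∈ =
  subst (proj₁ c ≤_) s≡n (maximal c∈) , subst (_< proj₂ c) s≡n (permutation g∈ c∈)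
  where
  overall = greatest-source (proj₂ (root-chord D 1≤n))
  g∈ = proj₁ (proj₂ overall)
  maximal = proj₂ (proj₂ overall)
  s = proj₁ (proj₁ overall)
  sources-unique : Unique (map proj₁ C)
  sources-unique = Unique-map⁺-on proj₁ (IsDiagram.unique D)
                     (λ p q e → IsDiagram.disjoint D p q (inj₁ refl) (inj₁ e))
  inside : ∀ {x} → x ∈ map proj₁ C → 1 ≤ x × x < 1 + s
  inside x∈ with ∈-map⁻ proj₁ x∈
  ... | d , d∈ , refl = IsDiagram.1≤src D d∈ , s≤s (maximal d∈)
  complete : ∀ {x} → 1 ≤ x → x < 1 + s → x ∈ map proj₁ C
  complete 1≤x x≤s with IsDiagram.covering D 1≤x (≤-trans (≤-pred x≤s) (<⇒≤ (<-≤-trans (IsDiagram.src<snk D g∈) (IsDiagram.snk≤2n D g∈))))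
  ... | d , d∈ , inj₁ refl = ∈-map⁺ proj₁ d∈
  ... | d , d∈ , inj₂ refl = ⊥-elim (<⇒≱ (permutation g∈ d∈) (≤-pred x≤s))
  s≡n : s ≡ n
  s≡n = trans (sym (interval-length 1 s sources-unique inside complete))
              (trans (length-map proj₁ C) (IsDiagram.length≡ D))

-- If the root chord is (1 , K) with K > n + 1, the chords ending before K are closed under
-- crossing (a crossing chord ending after K would form a 213 together with the root chord),
-- so the chord ending at n + 1 is not connected to the root chord.
connected⇒full-root : ∀ {n C} → IsDiagram n C → SplitAt n C → ¬ Contains213 C → Connected C → 1 ≤ n →
                      (1 , suc n) ∈ C
connected⇒full-root {n} {C} D split no213 connected 1≤n with root-chord D 1≤n
... | K , root∈ with K ≟ suc n
...   | yes refl = root∈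
...   | no  K≢n+1 = ⊥-elim (<-irrefl refl (fold (λ c d → EndsBefore c → EndsBefore d) (λ r k → k ∘ crossing-preserves r) id
                                                   (connected e∈ root∈) e-ends-before))
  where
  n+1<K : suc n < K
  n+1<K = ≤∧≢⇒< (proj₂ (split root∈)) (K≢n+1 ∘ sym)
  EndsBefore : Chord → Set
  EndsBefore c = proj₂ c < K
  chord-at-n+1 = IsDiagram.covering D {suc n} (s≤s z≤n) (n<2*n 1≤n)
  e = proj₁ chord-at-n+1
  e∈ = proj₁ (proj₂ chord-at-n+1)
  e-ends-before : EndsBefore e
  e-ends-before with proj₂ (proj₂ chord-at-n+1)
  ... | inj₁ n+1≡a = ⊥-elim (1+n≰n (subst (_≤ n) (sym n+1≡a) (proj₁ (split e∈))))
  ... | inj₂ n+1≡b = subst (_< K) n+1≡b n+1<K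
  crossing-preserves : ∀ {c d} → CrossIn C c d → EndsBefore c → EndsBefore d
  crossing-preserves {c} {d} (c∈ , d∈ , crossing) c<K with proj₂ d <? K | proj₂ d ≟ K
  ... | yes d<K | _ = d<K
  ... | no  _   | yes d≡K with IsDiagram.disjoint D d∈ root∈ (inj₂ refl) (inj₂ d≡K)
  ...   | refl with crossing
  ...     | inj₁ (1<a , _)     = ⊥-elim (<⇒≱ 1<a (IsDiagram.1≤src D c∈))
  ...     | inj₂ (_ , _ , K<b) = ⊥-elim (<-asym c<K K<b)
  crossing-preserves {c} {d} (c∈ , d∈ , crossing) c<K | no d≮K | no d≢K =
    ⊥-elim (no213 (c , (1 , K) , d , c∈ , root∈ , d∈ , (c<K , K<d) , (1<c , c<d crossing)))
    where
    K<d : K < proj₂ d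
    K<d = ≤∧≢⇒< (≮⇒≥ d≮K) (d≢K ∘ sym)
    1<c : 1 < proj₁ c
    1<c = ≥1∧≢1⇒≥2 (IsDiagram.1≤src D c∈)
            (λ a≡1 → <-irrefl refl (subst (_< K) (cong proj₂ (IsDiagram.disjoint D c∈ root∈ (inj₁ refl) (inj₁ a≡1))) c<K))
    c<d : Crosses c d → proj₁ c < proj₁ d
    c<d (inj₁ (c<d , _ , _)) = c<d
    c<d (inj₂ (_ , _ , d<c)) = ⊥-elim (<-asym (<-trans c<K K<d) d<c)

Contains213-reflect : ∀ {f} → StrictlyMonotone f → ∀ {C c₁ c₂ c₃} → c₁ ∈ C → c₂ ∈ C → c₃ ∈ C →
                      f (proj₂ c₁) < f (proj₂ c₂) → f (proj₂ c₂) < f (proj₂ c₃) →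
                      f (proj₁ c₂) < f (proj₁ c₁) → f (proj₁ c₁) < f (proj₁ c₃) → Contains213 C
Contains213-reflect f-mono {c₁ = c₁} {c₂} {c₃} c₁∈ c₂∈ c₃∈ b₁<b₂ b₂<b₃ a₂<a₁ a₁<a₃ =
  c₁ , c₂ , c₃ , c₁∈ , c₂∈ , c₃∈ , (reflect b₁<b₂ , reflect b₂<b₃) , (reflect a₂<a₁ , reflect a₁<a₃)
  where reflect = monotone-reflects-< f-mono

Contains213-map : ∀ {f} → StrictlyMonotone f → ∀ {C C′} → (∀ {c} → c ∈ C → mapChord f c ∈ C′) →
                  Contains213 C → Contains213 C′
Contains213-map {f} f-mono embed (c₁ , c₂ , c₃ , c₁∈ , c₂∈ , c₃∈ , (b₁<b₂ , b₂<b₃) , (a₂<a₁ , a₁<a₃)) =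
  mapChord f c₁ , mapChord f c₂ , mapChord f c₃ , embed c₁∈ , embed c₂∈ , embed c₃∈ ,
  (f-mono b₁<b₂ , f-mono b₂<b₃) , (f-mono a₂<a₁ , f-mono a₁<a₃)

-- The relabelling of the whole inner diagram, root chord (1 , k) ↦ (1 , k + j) included.
shiftInner : ℕ → ℕ → ℕ
shiftInner j x = if x ≤ᵇ 1 then x else x + j

shiftInner-≤ : ∀ j {x} → x ≤ 1 → shiftInner j x ≡ x
shiftInner-≤ j {x} x≤1 with x ≤ᵇ 1 in eq
... | true  = refl
... | false = ⊥-elim (<⇒≱ (≤ᵇ≡false⇒> _ _ eq) x≤1)

shiftInner-> : ∀ j {x} → 1 < x → shiftInner j x ≡ x + j
shiftInner-> j {x} 1<x with x ≤ᵇ 1 in eq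
... | true  = ⊥-elim (<⇒≱ 1<x (≤ᵇ≡true⇒≤ _ _ eq))
... | false = refl

shiftInner-mono : ∀ j → StrictlyMonotone (shiftInner j)
shiftInner-mono j {p} {q} p<q with p ≤? 1 | q ≤? 1
... | yes p≤1 | yes q≤1 rewrite shiftInner-≤ j p≤1 | shiftInner-≤ j q≤1             = p<q
... | yes p≤1 | no  q≰1 rewrite shiftInner-≤ j p≤1 | shiftInner-> j (≰⇒> q≰1)       = ≤-trans p<q (m≤m+n q j)
... | no  p≰1 | yes q≤1 = ⊥-elim (p≰1 (≤-trans (<⇒≤ p<q) q≤1))
... | no  p≰1 | no  q≰1 rewrite shiftInner-> j (≰⇒> p≰1) | shiftInner-> j (≰⇒> q≰1) = +-monoˡ-< j p<q

≤shiftInner : ∀ j x → x ≤ shiftInner j x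
≤shiftInner j x with x ≤? 1
... | yes x≤1 rewrite shiftInner-≤ j x≤1       = ≤-refl
... | no  x≰1 rewrite shiftInner-> j (≰⇒> x≰1) = m≤m+n x j

-- Grafting at the last place puts every inner sink before every outer sink, and every inner
-- source except that of the root chord after every outer source.
module LadderGraft {m n'' : ℕ} {T' C'' : Diagram}
                   (D' : IsDiagram m ((1 , suc m) ∷ T')) (D'' : IsDiagram n'' C'')
                   (split' : SplitAt m ((1 , suc m) ∷ T')) (split'' : SplitAt n'' C'') (1≤n'' : 1 ≤ n'')
                   (no213' : ¬ Contains213 ((1 , suc m) ∷ T')) (no213'' : ¬ Contains213 C'') where

  C' C : Diagram
  C' = (1 , suc m) ∷ T'
  C  = graftDiagram (suc m) n'' m T' C''

  F G : ℕ → ℕ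
  F = shiftOuter n'' m
  G = shiftInner n''

  1≤m : 1 ≤ m
  1≤m = subst (1 ≤_) (IsDiagram.length≡ D') (s≤s z≤n)

  2≤T'-endpoint : ∀ {d e} → d ∈ T' → IsEndpoint e d → 2 ≤ e
  2≤T'-endpoint d∈ e∈d = ≥1∧≢1⇒≥2 (proj₁ (IsDiagram.endpoint-bounds D' (there d∈) e∈d))
                                  (λ e≡1 → head-disjoint D' d∈ e∈d (inj₁ e≡1))

  2≤sink : ∀ {c} → c ∈ C' → 2 ≤ proj₂ c
  2≤sink c∈ = ≤-trans (s≤s (IsDiagram.1≤src D' c∈)) (IsDiagram.src<snk D' c∈)

  G-on-T' : ∀ {d} → d ∈ T' → mapChord G d ≡ mapChord (_+ n'') d
  G-on-T' d∈ = cong₂ _,_ (shiftInner-> n'' (2≤T'-endpoint d∈ (inj₁ refl)))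
                         (shiftInner-> n'' (2≤T'-endpoint d∈ (inj₂ refl)))

  inner-or-outer : ∀ {c} → c ∈ C →
                   (∃ λ c' → c' ∈ C' × c ≡ mapChord G c') ⊎ (∃ λ c'' → c'' ∈ C'' × c ≡ mapChord F c'')
  inner-or-outer c∈ with ∈-graftDiagram⁻ {suc m} {n''} {m} {T'} {C''} c∈
  ... | inj₁ refl                   = inj₁ (_ , here refl , cong (1 ,_) (sym (shiftInner-> n'' (s≤s 1≤m))))
  ... | inj₂ (inj₁ (d , d∈ , refl)) = inj₁ (d , there d∈ , sym (G-on-T' d∈))
  ... | inj₂ (inj₂ (d , d∈ , refl)) = inj₂ (d , d∈ , refl)

  inner-sink≤ : ∀ {c'} → c' ∈ C' → G (proj₂ c') ≤ 2 * m + n''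
  inner-sink≤ c∈ rewrite shiftInner-> n'' (2≤sink c∈) = +-monoˡ-≤ n'' (IsDiagram.snk≤2n D' c∈)

  outer-sink> : ∀ {c''} → c'' ∈ C'' → 2 * m + n'' < F (proj₂ c'')
  outer-sink> {c''} c∈ rewrite shiftOuter-> n'' m (proj₂ (split'' c∈)) =
    subst (_< proj₂ c'' + 2 * m) (+-comm n'' (2 * m)) (+-monoˡ-< (2 * m) (proj₂ (split'' c∈)))

  outer-source≤ : ∀ {c''} → c'' ∈ C'' → F (proj₁ c'') ≤ suc n''
  outer-source≤ c∈ rewrite shiftOuter-≤ n'' m (proj₁ (split'' c∈)) = s≤s (proj₁ (split'' c∈))

  inner-source : ∀ {c'} → c' ∈ C' → c' ≡ (1 , suc m) ⊎ 2 + n'' ≤ G (proj₁ c')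
  inner-source (here refl) = inj₁ refl
  inner-source (there d∈) rewrite shiftInner-> n'' (2≤T'-endpoint d∈ (inj₁ refl)) =
    inj₂ (+-monoˡ-≤ n'' (2≤T'-endpoint d∈ (inj₁ refl)))

  1≤source : ∀ {c} → c ∈ C → 1 ≤ proj₁ c
  1≤source c∈ with inner-or-outer c∈
  ... | inj₁ (c' , c'∈ , refl)   = ≤-trans (IsDiagram.1≤src D' c'∈) (≤shiftInner n'' _)
  ... | inj₂ (c'' , c''∈ , refl) = ≤-trans (IsDiagram.1≤src D'' c''∈) (≤shiftOuter n'' m _)

  splitAt : SplitAt (m + n'') C
  splitAt c∈ with ∈-graftDiagram⁻ {suc m} {n''} {m} {T'} {C''} c∈
  ... | inj₁ refl = ≤-trans 1≤m (m≤m+n m n'') , n<1+n (m + n'')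
  ... | inj₂ (inj₁ (d , d∈ , refl)) = +-monoˡ-≤ n'' (proj₁ (split' (there d∈))) , +-monoˡ-< n'' (proj₂ (split' (there d∈)))
  ... | inj₂ (inj₂ (d , d∈ , refl)) = ≤-trans (outer-source≤ d∈) (+-monoˡ-≤ n'' 1≤m) ,
    <-trans (+-monoˡ-< n'' (subst (_< 2 * m) (+-identityʳ m) (+-monoʳ-< m (subst (0 <_) (sym (+-identityʳ m)) 1≤m))))
            (outer-sink> d∈)

  no213 : ¬ Contains213 C
  no213 (c₁ , c₂ , c₃ , c₁∈ , c₂∈ , c₃∈ , (b₁<b₂ , b₂<b₃) , (a₂<a₁ , a₁<a₃))
    with inner-or-outer c₁∈ | inner-or-outer c₂∈ | inner-or-outer c₃∈
  ... | inj₁ (x₁ , x₁∈ , refl) | inj₁ (x₂ , x₂∈ , refl) | inj₁ (x₃ , x₃∈ , refl) =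
    no213' (Contains213-reflect (shiftInner-mono n'') x₁∈ x₂∈ x₃∈ b₁<b₂ b₂<b₃ a₂<a₁ a₁<a₃)
  ... | inj₂ (y₁ , y₁∈ , refl) | inj₂ (y₂ , y₂∈ , refl) | inj₂ (y₃ , y₃∈ , refl) =
    no213'' (Contains213-reflect (shiftOuter-mono n'' 1≤m) y₁∈ y₂∈ y₃∈ b₁<b₂ b₂<b₃ a₂<a₁ a₁<a₃)
  ... | _ | inj₂ (y₂ , y₂∈ , refl) | inj₁ (x₃ , x₃∈ , refl) =
    <-asym b₂<b₃ (≤-<-trans (inner-sink≤ x₃∈) (outer-sink> y₂∈))
  ... | inj₂ (y₁ , y₁∈ , refl) | inj₁ _ | inj₁ (x₃ , x₃∈ , refl) =
    <-asym (<-trans b₁<b₂ b₂<b₃) (≤-<-trans (inner-sink≤ x₃∈) (outer-sink> y₁∈))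
  ... | inj₁ (x₁ , x₁∈ , refl) | _ | inj₂ (y₃ , y₃∈ , refl) with inner-source x₁∈
  ...   | inj₁ refl = <⇒≱ a₂<a₁ (1≤source c₂∈)
  ...   | inj₂ n''+2≤ = 1+n≰n (≤-trans n''+2≤ (≤-trans (<⇒≤ a₁<a₃) (outer-source≤ y₃∈)))
  no213 (c₁ , c₂ , c₃ , c₁∈ , c₂∈ , c₃∈ , (b₁<b₂ , b₂<b₃) , (a₂<a₁ , a₁<a₃))
    | inj₂ (y₁ , y₁∈ , refl) | inj₁ (x₂ , x₂∈ , refl) | inj₂ _ with inner-source x₂∈
  ...   | inj₁ refl = <-asym b₁<b₂ (≤-<-trans (inner-sink≤ x₂∈) (outer-sink> y₁∈))
  ...   | inj₂ n''+2≤ = 1+n≰n (≤-trans n''+2≤ (≤-trans (<⇒≤ a₂<a₁) (outer-source≤ y₁∈)))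

LadderInvariant : ∀ {t} → Tubing t → Set
LadderInvariant {t} τ = SplitAt (size t) (θ τ) × rootSinkOf τ ≡ suc (size t) × ¬ Contains213 (θ τ)

θ-ladder-graft : ∀ {t' t''} (τ' : Tubing t') (τ'' : Tubing t'') (i : Fin (rtips t'')) →
                 rootSinkOf τ' ≡ suc (size t') → suc (toℕ i) ≡ size t'' →
                 θ (graft τ' τ'' i) ≡ graftDiagram (suc (size t')) (size t'') (size t') (nonRootOf τ') (θ τ'')
θ-ladder-graft {t'} τ' τ'' i k≡ j≡ =
  trans (θ-graft τ' τ'' i (θ-isDiagram τ'))
        (cong₂ (λ k j → graftDiagram k j (size t') (nonRootOf τ') (θ τ'')) k≡ j≡)

θ-full-root : ∀ {t} (τ : Tubing t) → rootSinkOf τ ≡ suc (size t) → θ τ ≡ (1 , suc (size t)) ∷ nonRootOf τ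
θ-full-root τ k≡ = trans (θ-head τ) (cong (λ k → (1 , k) ∷ nonRootOf τ) k≡)

ladder-invariant : ∀ {t} (τ : Tubing t) → IsLadder t → LadderInvariant τ
ladder-invariant vert _ = (λ { (here refl) → s≤s z≤n , s≤s (s≤s z≤n) }) , refl ,
                          (λ { (_ , _ , _ , here refl , here refl , here refl , (b<b , _) , _) → <-irrefl refl b<b })
ladder-invariant (graft {t'} {t''} τ' τ'' i) ladder with ladder-insert⁻ t'' (toℕ i) t' (toℕ<n i) ladder
... | ladder'' , ladder' , j≡ with ladder-invariant τ' ladder' | ladder-invariant τ'' ladder''
...   | split' , k≡ , no213' | split'' , _ , no213'' =
  subst₂ SplitAt (size-graft i) (sym θ≡) LG.splitAt ,
  trans (cong₂ _+_ k≡ j≡) (cong suc (size-graft i)) ,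
  subst (λ C → ¬ Contains213 C) (sym θ≡) LG.no213
  where
  θ≡ = θ-ladder-graft τ' τ'' i k≡ j≡
  θ'≡ = θ-full-root τ' k≡
  module LG = LadderGraft (subst (IsDiagram (size t')) θ'≡ (θ-isDiagram τ')) (θ-isDiagram τ'')
                          (subst (SplitAt (size t')) θ'≡ split') split'' (1≤size t'')
                          (subst (λ C → ¬ Contains213 C) θ'≡ no213') no213''

module GraftInjective {m n'' k j : ℕ} {T₁ C₁ T₂ C₂ : Diagram}
                      (D₁' : IsDiagram m ((1 , k) ∷ T₁)) (D₁'' : IsDiagram n'' C₁)
                      (D₂' : IsDiagram m ((1 , k) ∷ T₂)) (D₂'' : IsDiagram n'' C₂)
                      (j<2n : suc j ≤ 2 * n'') where

  module G₁ = GraftIsDiagram D₁' D₁'' j<2n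
  module G₂ = GraftIsDiagram D₂' D₂'' j<2n
  open G₁ using (F; F-injective; +j-injective; inner≢outer; 1≢inner; 1≢outer)

  InnerBounds OuterBounds : Diagram → Set
  InnerBounds T = ∀ {d e} → d ∈ T → IsEndpoint e d → 2 ≤ e × e ≤ 2 * m × e ≢ k
  OuterBounds C = ∀ {d p} → d ∈ C → IsEndpoint p d → 1 ≤ p × p ≤ 2 * n''

  outer⊆ : ∀ {T C T′ C′} → InnerBounds T′ → OuterBounds C →
           graftDiagram k j m T C ↭ graftDiagram k j m T′ C′ → C ⊆ C′
  outer⊆ {T} {C} {T′} {C′} inner′ outer p {d} d∈
    with ∈-graftDiagram⁻ {k} {j} {m} {T′} {C′} (∈-resp-↭ p (∈-graftDiagram-outer {k} {j} {m} {T} {C} d∈))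
  ... | inj₁ e = ⊥-elim (1≢outer {proj₁ d} (proj₁ (outer d∈ (inj₁ refl))) (sym (cong proj₁ e)))
  ... | inj₂ (inj₁ (d′ , d′∈ , e)) =
    ⊥-elim (inner≢outer {p = proj₁ d} (proj₁ (inner′ d′∈ (inj₁ refl))) (proj₁ (proj₂ (inner′ d′∈ (inj₁ refl))))
                                      (sym (cong proj₁ e)))
  ... | inj₂ (inj₂ (d′ , d′∈ , e)) = subst (_∈ C′) (sym (mapChord-injective F-injective e)) d′∈

  inner⊆ : ∀ {T C T′ C′} → InnerBounds T →
           graftDiagram k j m T C ↭ graftDiagram k j m T′ C′ → T ⊆ T′
  inner⊆ {T} {C} {T′} {C′} inner p {d} d∈
    with ∈-graftDiagram⁻ {k} {j} {m} {T′} {C′} (∈-resp-↭ p (∈-graftDiagram-inner {k} {j} {m} {T} {C} d∈))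
  ... | inj₁ e = ⊥-elim (1≢inner (proj₁ (inner d∈ (inj₁ refl))) (sym (cong proj₁ e)))
  ... | inj₂ (inj₁ (d′ , d′∈ , e)) = subst (_∈ T′) (sym (mapChord-injective +j-injective e)) d′∈
  ... | inj₂ (inj₂ (d′ , d′∈ , e)) =
    ⊥-elim (inner≢outer {p = proj₁ d′} (proj₁ (inner d∈ (inj₁ refl))) (proj₁ (proj₂ (inner d∈ (inj₁ refl))))
                                       (cong proj₁ e))

  module _ (p : graftDiagram k j m T₁ C₁ ↭ graftDiagram k j m T₂ C₂) where

    inner↭ : T₁ ↭ T₂
    inner↭ = ⊆∧⊇⇒↭ _≟ᶜ_ G₁.unique-T' G₂.unique-T' (inner⊆ G₁.inner-endpoint p) (inner⊆ G₂.inner-endpoint (↭-sym p))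

    outer↭ : C₁ ↭ C₂
    outer↭ = ⊆∧⊇⇒↭ _≟ᶜ_ (IsDiagram.unique D₁'') (IsDiagram.unique D₂'')
                     (outer⊆ G₂.inner-endpoint G₁.outer-endpoint p) (outer⊆ G₁.inner-endpoint G₂.outer-endpoint (↭-sym p))

graft-sizes-injective : ∀ {m₁ n₁ m₂ n₂} → suc n₁ + 2 * m₁ ≡ suc n₂ + 2 * m₂ → m₁ + n₁ ≡ m₂ + n₂ →
                        m₁ ≡ m₂ × n₁ ≡ n₂
graft-sizes-injective {m₁} {n₁} {m₂} {n₂} e₁ e₂ = m₁≡m₂ , +-cancelˡ-≡ m₁ _ _ (trans e₂ (cong (_+ n₂) (sym m₁≡m₂)))
  where
  rearrange : ∀ n m → n + 2 * m ≡ (m + n) + m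
  rearrange n m = trans (cong (n +_) (cong (m +_) (+-identityʳ m)))
                        (trans (sym (+-assoc n m m)) (cong (_+ m) (+-comm n m)))
  m₁≡m₂ : m₁ ≡ m₂
  m₁≡m₂ = +-cancelˡ-≡ (m₁ + n₁) _ _
            (trans (trans (sym (rearrange n₁ m₁)) (trans (suc-injective e₁) (rearrange n₂ m₂))) (cong (_+ m₂) (sym e₂)))

module LadderGraftParts {t' t''} (τ' : Tubing t') (τ'' : Tubing t'') (i : Fin (rtips t''))
                        (ladder' : IsLadder t') (ladder'' : IsLadder t'') (j≡ : suc (toℕ i) ≡ size t'') where

  m n'' : ℕ
  m   = size t'
  n'' = size t''

  k≡ : rootSinkOf τ' ≡ suc m
  k≡ = proj₁ (proj₂ (ladder-invariant τ' ladder'))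

  θ≡ : θ (graft τ' τ'' i) ≡ graftDiagram (suc m) n'' m (nonRootOf τ') (θ τ'')
  θ≡ = θ-ladder-graft τ' τ'' i k≡ j≡

  θ'≡ : θ τ' ≡ (1 , suc m) ∷ nonRootOf τ'
  θ'≡ = θ-full-root τ' k≡

  D' : IsDiagram m ((1 , suc m) ∷ nonRootOf τ')
  D' = subst (IsDiagram m) θ'≡ (θ-isDiagram τ')

  n<2n : suc n'' ≤ 2 * n''
  n<2n = n<2*n (1≤size t'')

  -- The outer root chord (1 , n'' + 1) becomes (2 , n'' + 1 + 2m).
  chord-at-2 : (2 , suc n'' + 2 * m) ∈ θ (graft τ' τ'' i)
  chord-at-2 = subst (_∈ θ (graft τ' τ'' i))
    (cong₂ _,_ (shiftOuter-≤ n'' m (1≤size t'')) (shiftOuter-> n'' m ≤-refl))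
    (subst (mapChord (shiftOuter n'' m) (1 , suc n'') ∈_) (sym θ≡)
      (∈-graftDiagram-outer {suc m} {n''} {m} {nonRootOf τ'} {θ τ''}
        (subst ((1 , suc n'') ∈_) (sym (θ-full-root τ'' (proj₁ (proj₂ (ladder-invariant τ'' ladder''))))) (here refl))))

  size≡ : size (insert t'' (toℕ i) t') ≡ m + n''
  size≡ = sym (size-graft i)

θ-ladder-injective : ∀ {t₁ t₂} (τ₁ : Tubing t₁) (τ₂ : Tubing t₂) → IsLadder t₁ → IsLadder t₂ →
                     θ τ₁ ↭ θ τ₂ → _≡_ {A = Σ PTree Tubing} (t₁ , τ₁) (t₂ , τ₂)
θ-ladder-injective vert vert _ _ _ = refl
θ-ladder-injective vert (graft τ' τ'' i) _ _ p = ⊥-elim (θ-vert≭θ-graft τ' τ'' i p)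
θ-ladder-injective (graft τ' τ'' i) vert _ _ p = ⊥-elim (θ-vert≭θ-graft τ' τ'' i (↭-sym p))
θ-ladder-injective (graft {t'₁} {t''₁} τ'₁ τ''₁ i₁) (graft {t'₂} {t''₂} τ'₂ τ''₂ i₂) ladder₁ ladder₂ p
  with ladder-insert⁻ t''₁ (toℕ i₁) t'₁ (toℕ<n i₁) ladder₁ | ladder-insert⁻ t''₂ (toℕ i₂) t'₂ (toℕ<n i₂) ladder₂
... | ladder''₁ , ladder'₁ , j≡₁ | ladder''₂ , ladder'₂ , j≡₂ = same-graft inner-same outer-same
  where
  module P₁ = LadderGraftParts τ'₁ τ''₁ i₁ ladder'₁ ladder''₁ j≡₁
  module P₂ = LadderGraftParts τ'₂ τ''₂ i₂ ladder'₂ ladder''₂ j≡₂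
  sizes : P₁.m ≡ P₂.m × P₁.n'' ≡ P₂.n''
  sizes = graft-sizes-injective {P₁.m} {P₁.n''} {P₂.m} {P₂.n''}
    (cong proj₂ (IsDiagram.disjoint (θ-isDiagram (graft τ'₂ τ''₂ i₂)) (∈-resp-↭ p P₁.chord-at-2) P₂.chord-at-2
                                    (inj₁ refl) (inj₁ refl)))
    (trans (sym P₁.size≡) (trans (sym (IsDiagram.length≡ (θ-isDiagram (graft τ'₁ τ''₁ i₁))))
      (trans (↭-length p) (trans (IsDiagram.length≡ (θ-isDiagram (graft τ'₂ τ''₂ i₂))) P₂.size≡))))
  m≡ = proj₁ sizes
  n≡ = proj₂ sizes
  p′ : graftDiagram (suc P₁.m) P₁.n'' P₁.m (nonRootOf τ'₁) (θ τ''₁) ↭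
       graftDiagram (suc P₁.m) P₁.n'' P₁.m (nonRootOf τ'₂) (θ τ''₂)
  p′ = subst₂ (λ a b → graftDiagram (suc P₁.m) P₁.n'' P₁.m (nonRootOf τ'₁) (θ τ''₁) ↭
                       graftDiagram (suc a) b a (nonRootOf τ'₂) (θ τ''₂))
              (sym m≡) (sym n≡) (subst₂ _↭_ P₁.θ≡ P₂.θ≡ p)
  module GI = GraftInjective P₁.D' (θ-isDiagram τ''₁)
                (subst (λ a → IsDiagram a ((1 , suc a) ∷ nonRootOf τ'₂)) (sym m≡) P₂.D')
                (subst (λ b → IsDiagram b (θ τ''₂)) (sym n≡) (θ-isDiagram τ''₂)) P₁.n<2n
  inner-same : _≡_ {A = Σ PTree Tubing} (t'₁ , τ'₁) (t'₂ , τ'₂)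
  inner-same = θ-ladder-injective τ'₁ τ'₂ ladder'₁ ladder'₂
    (subst₂ _↭_ (sym P₁.θ'≡) (trans (cong (λ a → (1 , suc a) ∷ nonRootOf τ'₂) m≡) (sym P₂.θ'≡)) (prep _ (GI.inner↭ p′)))
  outer-same : _≡_ {A = Σ PTree Tubing} (t''₁ , τ''₁) (t''₂ , τ''₂)
  outer-same = θ-ladder-injective τ''₁ τ''₂ ladder''₁ ladder''₂ (GI.outer↭ p′)
  same-graft : _≡_ {A = Σ PTree Tubing} (t'₁ , τ'₁) (t'₂ , τ'₂) → _≡_ {A = Σ PTree Tubing} (t''₁ , τ''₁) (t''₂ , τ''₂) →
               _≡_ {A = Σ PTree Tubing} (_ , graft τ'₁ τ''₁ i₁) (_ , graft τ'₂ τ''₂ i₂)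
  same-graft refl refl = graft-cong τ'₁ τ''₁ (suc-injective (trans j≡₁ (sym j≡₂)))

LadderPreimage : Diagram → Set
LadderPreimage C = Σ PTree λ t → Σ (Tubing t) λ τ → IsLadder t × (θ τ ↭ C)

-- The chords of C other than the root chord split into those ending before the sink s₂ of the
-- chord starting at 2 (they form the inner diagram) and the others (the outer diagram).
module LadderSplit {N : ℕ} {C : Diagram} (D : IsDiagram N C) (split : SplitAt N C) (no213 : ¬ Contains213 C)
                   (root∈ : (1 , suc N) ∈ C) {s₂ : ℕ} (s₂-chord∈ : (2 , s₂) ∈ C) where

  root : Chord
  root = (1 , suc N)

  InnerChord : Chord → Set
  InnerChord c = proj₂ c < s₂ × proj₁ c ≢ 1

  inner? : ∀ c → Dec (InnerChord c)
  inner? c = (proj₂ c <? s₂) ×-dec ¬? (proj₁ c ≟ 1)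

  OuterChord : Chord → Set
  OuterChord c = s₂ ≤ proj₂ c

  outer? : ∀ c → Dec (OuterChord c)
  outer? c = s₂ ≤? proj₂ c

  A B : Diagram
  A = filter inner? C
  B = filter outer? C

  ∈A⁻ : ∀ {d} → d ∈ A → d ∈ C × InnerChord d
  ∈A⁻ = ∈-filter⁻ inner?

  ∈B⁻ : ∀ {d} → d ∈ B → d ∈ C × OuterChord d
  ∈B⁻ = ∈-filter⁻ outer?

  N+1<s₂ : suc N < s₂
  N+1<s₂ = ≤∧≢⇒< (proj₂ (split s₂-chord∈))
    (λ e → 1+n≰n (subst (_≤ 1) (cong proj₁ (IsDiagram.disjoint D root∈ s₂-chord∈ (inj₂ refl) (inj₂ e))) ≤-refl))

  source-1⇒root : ∀ {c} → c ∈ C → proj₁ c ≡ 1 → c ≡ root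
  source-1⇒root c∈ e = IsDiagram.disjoint D c∈ root∈ (inj₁ refl) (inj₁ e)

  chord-cases : ∀ {c} → c ∈ C → c ≡ root ⊎ c ∈ A ⊎ c ∈ B
  chord-cases {c} c∈ with proj₁ c ≟ 1 | proj₂ c <? s₂
  ... | yes a≡1 | _       = inj₁ (source-1⇒root c∈ a≡1)
  ... | no  a≢1 | yes b<s = inj₂ (inj₁ (∈-filter⁺ inner? c∈ (b<s , a≢1)))
  ... | no  _   | no  b≮s = inj₂ (inj₂ (∈-filter⁺ outer? c∈ (≮⇒≥ b≮s)))

  C↭root∷A++B : C ↭ root ∷ A ++ B
  C↭root∷A++B = ⊆∧⊇⇒↭ _≟ᶜ_ (IsDiagram.unique D) unique-split to from
    where
    root∉ : ∀ {c} → c ∈ A ++ B → root ≢ c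
    root∉ q e with ∈-++⁻ A q
    ... | inj₁ a = proj₂ (proj₂ (∈A⁻ a)) (sym (cong proj₁ e))
    ... | inj₂ b = <⇒≱ (subst (λ z → proj₂ z < s₂) e N+1<s₂) (proj₂ (∈B⁻ b))
    unique-split : Unique (root ∷ A ++ B)
    unique-split = All.tabulate root∉ ∷
      Unique.++⁺ (Unique.filter⁺ inner? (IsDiagram.unique D)) (Unique.filter⁺ outer? (IsDiagram.unique D))
                 (λ (a , b) → <⇒≱ (proj₁ (proj₂ (∈A⁻ a))) (proj₂ (∈B⁻ b)))
    to : C ⊆ root ∷ A ++ B
    to c∈ with chord-cases c∈
    ... | inj₁ refl     = here refl
    ... | inj₂ (inj₁ a) = there (∈-++⁺ˡ a)
    ... | inj₂ (inj₂ b) = there (∈-++⁺ʳ A b)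
    from : root ∷ A ++ B ⊆ C
    from (here refl) = root∈
    from (there q) with ∈-++⁻ A q
    ... | inj₁ a = proj₁ (∈A⁻ a)
    ... | inj₂ b = proj₁ (∈B⁻ b)

  N≡1+|A|+|B| : N ≡ suc (length A + length B)
  N≡1+|A|+|B| = trans (sym (IsDiagram.length≡ D)) (trans (↭-length C↭root∷A++B) (cong suc (length-++ A)))

  -- Where 213-avoidance enters: an outer chord starting after an inner one forms a 213 with (2 , s₂).
  outer-source<inner-source : ∀ {c d} → c ∈ B → d ∈ A → proj₁ c < proj₁ d
  outer-source<inner-source {c} {d} c∈B d∈A with ∈B⁻ c∈B | ∈A⁻ d∈A
  ... | c∈ , s≤c | d∈ , d<s , d≢1 with proj₂ c ≟ s₂ | proj₁ d <? proj₁ c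
  ...   | yes c≡s | _ = subst (_< proj₁ d) (cong proj₁ (sym (IsDiagram.disjoint D c∈ s₂-chord∈ (inj₂ refl) (inj₂ c≡s)))) 2<d
    where
    2<d : 2 < proj₁ d
    2<d = ≤∧≢⇒< (≥1∧≢1⇒≥2 (IsDiagram.1≤src D d∈) d≢1)
            (λ e → <-irrefl refl (subst (_< s₂) (cong proj₂ (IsDiagram.disjoint D d∈ s₂-chord∈ (inj₁ refl) (inj₁ (sym e)))) d<s))
  ...   | no c≢s | yes d<c = ⊥-elim (no213 (d , (2 , s₂) , c , d∈ , s₂-chord∈ , c∈ ,
                                          (d<s , ≤∧≢⇒< s≤c (c≢s ∘ sym)) , (2<d , d<c)))
    where
    2<d : 2 < proj₁ d
    2<d = ≤∧≢⇒< (≥1∧≢1⇒≥2 (IsDiagram.1≤src D d∈) d≢1)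
            (λ e → <-irrefl refl (subst (_< s₂) (cong proj₂ (IsDiagram.disjoint D d∈ s₂-chord∈ (inj₁ refl) (inj₁ (sym e)))) d<s))
  ...   | no c≢s | no d≮c = ≤∧≢⇒< (≮⇒≥ d≮c)
    (λ e → <-irrefl refl (<-≤-trans d<s (subst (s₂ ≤_) (cong proj₂ (IsDiagram.disjoint D c∈ d∈ (inj₁ refl) (inj₁ e))) s≤c)))

  s₂-chord∈B : (2 , s₂) ∈ B
  s₂-chord∈B = ∈-filter⁺ outer? s₂-chord∈ ≤-refl

  last-outer : ∃ λ g → g ∈ B × (∀ {c} → c ∈ B → proj₁ c ≤ proj₁ g)
  last-outer = greatest-source s₂-chord∈B

  p : ℕ
  p = proj₁ (proj₁ last-outer)

  outer-source-bounds : ∀ {c} → c ∈ B → 2 ≤ proj₁ c × proj₁ c ≤ p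
  outer-source-bounds c∈B with ∈B⁻ c∈B
  ... | c∈ , s≤c = ≥1∧≢1⇒≥2 (IsDiagram.1≤src D c∈) source≢1 , proj₂ (proj₂ last-outer) c∈B
    where
    source≢1 : _
    source≢1 a≡1 = <⇒≱ (subst (λ z → proj₂ z < s₂) (sym (source-1⇒root c∈ a≡1)) N+1<s₂) s≤c

  1≤p : 1 ≤ p
  1≤p = ≤-trans (s≤s z≤n) (proj₁ (outer-source-bounds (proj₁ (proj₂ last-outer))))

  p≤N : p ≤ N
  p≤N = proj₁ (split (proj₁ (∈B⁻ (proj₁ (proj₂ last-outer)))))

  unique-B : Unique B
  unique-B = Unique.filter⁺ outer? (IsDiagram.unique D)

  -- The sources of B are exactly 2, …, p.
  |B|≡p∸1 : length B ≡ p ∸ 1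
  |B|≡p∸1 = trans (sym (length-map proj₁ B)) (interval-length 2 (p ∸ 1) unique-sources inside complete)
    where
    2+[p∸1]≡1+p : 2 + (p ∸ 1) ≡ suc p
    2+[p∸1]≡1+p = cong suc (m+[n∸m]≡n 1≤p)
    unique-sources : Unique (map proj₁ B)
    unique-sources = Unique-map⁺-on proj₁ unique-B
      (λ c∈ d∈ e → IsDiagram.disjoint D (proj₁ (∈B⁻ c∈)) (proj₁ (∈B⁻ d∈)) (inj₁ refl) (inj₁ e))
    inside : ∀ {x} → x ∈ map proj₁ B → 2 ≤ x × x < 2 + (p ∸ 1)
    inside x∈ with ∈-map⁻ proj₁ x∈
    ... | c , c∈B , refl = proj₁ (outer-source-bounds c∈B) ,
                           subst (proj₁ c <_) (sym 2+[p∸1]≡1+p) (s≤s (proj₂ (outer-source-bounds c∈B)))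
    complete : ∀ {x} → 2 ≤ x → x < 2 + (p ∸ 1) → x ∈ map proj₁ B
    complete {x} 2≤x x<2+p∸1 with IsDiagram.covering D (≤-trans (s≤s z≤n) 2≤x) (≤-trans x≤p (≤-trans p≤N (m≤m+n N (N + 0))))
      where
      x≤p : x ≤ p
      x≤p = ≤-pred (subst (x <_) 2+[p∸1]≡1+p x<2+p∸1)
    ... | c , c∈ , inj₂ refl = ⊥-elim (<⇒≱ (proj₂ (split c∈)) (≤-trans (≤-pred (subst (x <_) 2+[p∸1]≡1+p x<2+p∸1)) p≤N))
    ... | c , c∈ , inj₁ refl with chord-cases c∈
    ...   | inj₁ refl      = ⊥-elim (1+n≰n 2≤x)
    ...   | inj₂ (inj₁ c∈A) = ⊥-elim (<⇒≱ (outer-source<inner-source (proj₁ (proj₂ last-outer)) c∈A)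
                                        (≤-pred (subst (x <_) 2+[p∸1]≡1+p x<2+p∸1)))
    ...   | inj₂ (inj₂ c∈B) = ∈-map⁺ proj₁ c∈B

  s₂≤2N+1 : s₂ ≤ suc (2 * N)
  s₂≤2N+1 = ≤-trans (IsDiagram.snk≤2n D s₂-chord∈) (n≤1+n _)

  -- The sinks of B are exactly s₂, …, 2N.
  |B|≡2N+1∸s₂ : length B ≡ suc (2 * N) ∸ s₂
  |B|≡2N+1∸s₂ = trans (sym (length-map proj₂ B)) (interval-length s₂ (suc (2 * N) ∸ s₂) unique-sinks inside complete)
    where
    s₂+[2N+1∸s₂]≡2N+1 = m+[n∸m]≡n s₂≤2N+1
    unique-sinks : Unique (map proj₂ B)
    unique-sinks = Unique-map⁺-on proj₂ unique-B
      (λ c∈ d∈ e → IsDiagram.disjoint D (proj₁ (∈B⁻ c∈)) (proj₁ (∈B⁻ d∈)) (inj₂ refl) (inj₂ e))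
    inside : ∀ {x} → x ∈ map proj₂ B → s₂ ≤ x × x < s₂ + (suc (2 * N) ∸ s₂)
    inside x∈ with ∈-map⁻ proj₂ x∈
    ... | c , c∈B , refl = proj₂ (∈B⁻ c∈B) ,
      subst (proj₂ c <_) (sym s₂+[2N+1∸s₂]≡2N+1) (s≤s (IsDiagram.snk≤2n D (proj₁ (∈B⁻ c∈B))))
    complete : ∀ {x} → s₂ ≤ x → x < s₂ + (suc (2 * N) ∸ s₂) → x ∈ map proj₂ B
    complete {x} s≤x x< with IsDiagram.covering D (≤-trans (s≤s z≤n) (≤-trans (s≤s z≤n) (≤-trans N+1<s₂ s≤x)))
                                                (≤-pred (subst (x <_) s₂+[2N+1∸s₂]≡2N+1 x<))
    ... | c , c∈ , inj₁ refl = ⊥-elim (<⇒≱ (<-trans (n<1+n N) (<-≤-trans N+1<s₂ s≤x)) (proj₁ (split c∈)))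
    ... | c , c∈ , inj₂ refl with chord-cases c∈
    ...   | inj₁ refl       = ⊥-elim (<⇒≱ N+1<s₂ s≤x)
    ...   | inj₂ (inj₁ c∈A) = ⊥-elim (<⇒≱ (proj₁ (proj₂ (∈A⁻ c∈A))) s≤x)
    ...   | inj₂ (inj₂ c∈B) = ∈-map⁺ proj₂ c∈B

  n'' m : ℕ
  n'' = length B
  m   = suc (length A)

  N≡m+n'' : N ≡ m + n''
  N≡m+n'' = N≡1+|A|+|B|

  s₂+n''≡2N+1 : s₂ + n'' ≡ suc (2 * N)
  s₂+n''≡2N+1 = trans (cong (s₂ +_) |B|≡2N+1∸s₂) (m+[n∸m]≡n s₂≤2N+1)

  p≡1+n'' : p ≡ suc n''
  p≡1+n'' = sym (trans (cong suc |B|≡p∸1) (m+[n∸m]≡n 1≤p))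

  1≤n'' : 1 ≤ n''
  1≤n'' = subst (1 ≤_) (sym |B|≡p∸1) (∸-monoˡ-≤ 1 (proj₂ (outer-source-bounds s₂-chord∈B)))

  inner-source-bounds : ∀ {d} → d ∈ A → suc (suc n'') ≤ proj₁ d × proj₁ d ≤ N
  inner-source-bounds d∈A = subst (_< _) p≡1+n'' (outer-source<inner-source (proj₁ (proj₂ last-outer)) d∈A) ,
                            proj₁ (split (proj₁ (∈A⁻ d∈A)))

  inner-sink-bounds : ∀ {d} → d ∈ A → suc (suc N) ≤ proj₂ d × proj₂ d < s₂
  inner-sink-bounds {d} d∈A = ≤∧≢⇒< (proj₂ (split d∈)) N+1≢b , proj₁ (proj₂ (∈A⁻ d∈A))
    where
    d∈ = proj₁ (∈A⁻ d∈A)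
    N+1≢b : suc N ≢ proj₂ d
    N+1≢b e = proj₂ (proj₂ (∈A⁻ d∈A)) (cong proj₁ (IsDiagram.disjoint D d∈ root∈ (inj₂ e) (inj₂ refl)))

  outer-source≤ : ∀ {c} → c ∈ B → proj₁ c ≤ suc n''
  outer-source≤ {c} c∈B = subst (proj₁ c ≤_) p≡1+n'' (proj₂ (outer-source-bounds c∈B))

module LadderDecomposition {N : ℕ} {C : Diagram} (D : IsDiagram N C) (split : SplitAt N C) (no213 : ¬ Contains213 C)
                           (root∈ : (1 , suc N) ∈ C) {s₂ : ℕ} (s₂-chord∈ : (2 , s₂) ∈ C) where

  open LadderSplit D split no213 root∈ s₂-chord∈ public

  1≤m : 1 ≤ m
  1≤m = s≤s z≤n

  -- The outer root chord (1 , n'' + 1) has become (2 , s₂).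
  s₂≡ : s₂ ≡ suc n'' + 2 * m
  s₂≡ = +-cancelʳ-≡ n'' s₂ (suc n'' + 2 * m) (begin
    s₂ + n''                   ≡⟨ s₂+n''≡2N+1 ⟩
    suc (2 * N)                ≡⟨ cong (λ n → suc (2 * n)) N≡m+n'' ⟩
    suc (2 * (m + n''))        ≡⟨ cong suc (*-distribˡ-+ 2 m n'') ⟩
    suc (2 * m + 2 * n'')      ≡⟨ cong (λ x → suc (2 * m + x)) (cong (n'' +_) (+-identityʳ n'')) ⟩
    suc (2 * m + (n'' + n''))  ≡⟨ cong suc (sym (+-assoc (2 * m) n'' n'')) ⟩
    suc (2 * m + n'' + n'')    ≡⟨ cong (λ x → suc (x + n'')) (+-comm (2 * m) n'') ⟩
    suc n'' + 2 * m + n''      ∎)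
    where open ≡-Reasoning

  h : ℕ → ℕ
  h = unshiftOuter n'' m

  T' C' C'' : Diagram
  T'  = map (mapChord (_∸ n'')) A
  C'  = (1 , suc m) ∷ T'
  C'' = map (mapChord h) B

  N≡n''+m : N ≡ n'' + m
  N≡n''+m = trans N≡m+n'' (+-comm m n'')

  A-source : ∀ {d} → d ∈ A → 2 ≤ proj₁ d ∸ n'' × proj₁ d ∸ n'' ≤ m
  A-source {d} d∈A with inner-source-bounds d∈A
  ... | 2+n''≤a , a≤N = subst (_≤ proj₁ d ∸ n'') (m+n∸n≡m 2 n'') (∸-monoˡ-≤ n'' 2+n''≤a) ,
                        m≤n+o⇒m∸n≤o (proj₁ d) n'' (subst (proj₁ d ≤_) N≡n''+m a≤N)

  A-sink : ∀ {d} → d ∈ A → suc (suc m) ≤ proj₂ d ∸ n'' × proj₂ d ∸ n'' ≤ 2 * m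
  A-sink {d} d∈A with inner-sink-bounds d∈A
  ... | 2+N≤b , b<s₂ =
    subst (_≤ proj₂ d ∸ n'') (m+n∸n≡m (suc (suc m)) n'')
      (∸-monoˡ-≤ n'' (subst (λ n → suc (suc n) ≤ proj₂ d) N≡m+n'' 2+N≤b)) ,
    m≤n+o⇒m∸n≤o (proj₂ d) n'' (≤-pred (subst (proj₂ d <_) s₂≡ b<s₂))

  A-restore : ∀ {d} → d ∈ A → mapChord (_+ n'') (mapChord (_∸ n'') d) ≡ d
  A-restore d∈A = cong₂ _,_
    (m∸n+n≡m (≤-trans (n≤1+n _) (≤-trans (n≤1+n _) (proj₁ (inner-source-bounds d∈A)))))
    (m∸n+n≡m (≤-trans (subst (n'' ≤_) (sym N≡m+n'') (m≤n+m n'' m))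
                        (≤-trans (n≤1+n N) (≤-trans (n≤1+n _) (proj₁ (inner-sink-bounds d∈A))))))

  T'-bounds : ∀ {d e} → d ∈ T' → IsEndpoint e d → 2 ≤ e × e ≤ 2 * m
  T'-bounds d∈ e∈d with ∈-map⁻ (mapChord (_∸ n'')) d∈
  ... | d , d∈A , refl with e∈d
  ...   | inj₁ refl = proj₁ (A-source d∈A) , ≤-trans (proj₂ (A-source d∈A)) (m≤m+n m (m + 0))
  ...   | inj₂ refl = ≤-trans (s≤s (s≤s z≤n)) (proj₁ (A-sink d∈A)) , proj₂ (A-sink d∈A)

  s₂≤ : ∀ {c} → c ∈ B → suc n'' + 2 * m ≤ proj₂ c
  s₂≤ c∈B = subst (_≤ _) s₂≡ (proj₂ (∈B⁻ c∈B))

  B-restore : ∀ {c} → c ∈ B → mapChord (shiftOuter n'' m) (mapChord h c) ≡ c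
  B-restore c∈B = cong₂ _,_
    (shiftOuter-unshiftOuter-≤ n'' m (≤-trans (s≤s z≤n) (proj₁ (outer-source-bounds c∈B))) (outer-source≤ c∈B))
    (shiftOuter-unshiftOuter-> n'' 1≤m (s₂≤ c∈B))

  graft≡ : graftDiagram (suc m) n'' m T' C'' ≡ root ∷ A ++ B
  graft≡ = cong₂ _∷_ (cong (λ n → (1 , suc n)) (sym N≡m+n''))
    (cong₂ _++_ (trans (sym (map-∘ A)) (map-id-local (All.tabulate A-restore)))
                (trans (sym (map-∘ B)) (map-id-local (All.tabulate B-restore))))

  module Components = GraftComponents {m} {n''} {suc m} {n''} {T'} {C''}
    (cong suc (length-map (mapChord (_∸ n'')) A)) (length-map (mapChord h) B)
    (s≤s 1≤m) (n<2*n 1≤m) (n<2*n 1≤n'') T'-bounds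
    (subst₂ IsDiagram N≡m+n'' (sym graft≡) (isDiagram-↭ C↭root∷A++B D))

  D' : IsDiagram m C'
  D' = Components.inner-isDiagram

  D'' : IsDiagram n'' C''
  D'' = Components.outer-isDiagram

  split' : SplitAt m C'
  split' (here refl) = 1≤m , n<1+n m
  split' (there q) with ∈-map⁻ (mapChord (_∸ n'')) q
  ... | d , d∈A , refl = proj₂ (A-source d∈A) , ≤-trans (n≤1+n _) (proj₁ (A-sink d∈A))

  split'' : SplitAt n'' C''
  split'' q with ∈-map⁻ (mapChord h) q
  ... | c , c∈B , refl = a≤ , b>
    where
    a≤ : h (proj₁ c) ≤ n''
    a≤ rewrite unshiftOuter-≤ n'' m (outer-source≤ c∈B) = ∸-monoˡ-≤ 1 (outer-source≤ c∈B)
    b> : n'' < h (proj₂ c)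
    b> rewrite unshiftOuter-> n'' m (<-≤-trans (m<m+n (suc n'') (≤-trans 1≤m (m≤m+n m (m + 0)))) (s₂≤ c∈B)) =
      subst (_≤ proj₂ c ∸ 2 * m) (m+n∸n≡m (suc n'') (2 * m)) (∸-monoˡ-≤ (2 * m) (s₂≤ c∈B))

  no213' : ¬ Contains213 C'
  no213' = no213 ∘ Contains213-map (shiftInner-mono n'') embed
    where
    embed : ∀ {c} → c ∈ C' → mapChord (shiftInner n'') c ∈ C
    embed (here refl) = subst (λ z → (1 , z) ∈ C)
      (sym (trans (shiftInner-> n'' (s≤s 1≤m)) (cong suc (sym N≡m+n'')))) root∈
    embed (there q) with ∈-map⁻ (mapChord (_∸ n'')) q
    ... | d , d∈A , refl = subst (_∈ C) (sym (trans shiftInner≡ (A-restore d∈A))) (proj₁ (∈A⁻ d∈A))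
      where
      shiftInner≡ : mapChord (shiftInner n'') (mapChord (_∸ n'') d) ≡ mapChord (_+ n'') (mapChord (_∸ n'') d)
      shiftInner≡ = cong₂ _,_ (shiftInner-> n'' (proj₁ (T'-bounds q (inj₁ refl))))
                              (shiftInner-> n'' (proj₁ (T'-bounds q (inj₂ refl))))

  no213'' : ¬ Contains213 C''
  no213'' = no213 ∘ Contains213-map (shiftOuter-mono n'' 1≤m) embed
    where
    embed : ∀ {c} → c ∈ C'' → mapChord (shiftOuter n'' m) c ∈ C
    embed q with ∈-map⁻ (mapChord h) q
    ... | c , c∈B , refl = subst (_∈ C) (sym (B-restore c∈B)) (proj₁ (∈B⁻ c∈B))

  root''∈ : (1 , suc n'') ∈ C''
  root''∈ = subst (_∈ C'')
    (cong₂ _,_ (unshiftOuter-≤ n'' m (s≤s 1≤n''))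
               (trans (unshiftOuter-> n'' m (<-≤-trans (m<m+n (suc n'') (≤-trans 1≤m (m≤m+n m (m + 0))))
                                                      (subst (_≤ s₂) s₂≡ ≤-refl)))
                      (trans (cong (_∸ 2 * m) s₂≡) (m+n∸n≡m (suc n'') (2 * m)))))
    (∈-map⁺ (mapChord h) s₂-chord∈B)

  preimage : LadderPreimage C' → LadderPreimage C'' → LadderPreimage C
  preimage (t' , τ' , ladder' , θτ'↭C') (t'' , τ'' , ladder'' , θτ''↭C'') =
    _ , graft τ' τ'' i , ladder-insert⁺ t'' t' (toℕ i) ladder'' ladder' j≡ , θ↭C
    where
    size' : size t' ≡ m
    size' = trans (sym (IsDiagram.length≡ (θ-isDiagram τ'))) (trans (↭-length θτ'↭C') (IsDiagram.length≡ D'))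
    size'' : size t'' ≡ n''
    size'' = trans (sym (IsDiagram.length≡ (θ-isDiagram τ''))) (trans (↭-length θτ''↭C'') (IsDiagram.length≡ D''))
    1+[n''∸1]≡n'' : suc (n'' ∸ 1) ≡ n''
    1+[n''∸1]≡n'' = trans (+-comm 1 (n'' ∸ 1)) (m∸n+n≡m 1≤n'')
    last-place : n'' ∸ 1 < rtips t''
    last-place = ≤-trans (≤-reflexive (trans 1+[n''∸1]≡n'' (sym size''))) (size≤rtips t'')
    i : Fin (rtips t'')
    i = fromℕ< last-place
    j≡ : suc (toℕ i) ≡ size t''
    j≡ = trans (cong suc (toℕ-fromℕ< last-place)) (trans 1+[n''∸1]≡n'' (sym size''))
    k≡ : rootSinkOf τ' ≡ suc (size t')
    k≡ = proj₁ (proj₂ (ladder-invariant τ' ladder'))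
    θ≡ : θ (graft τ' τ'' i) ≡ graftDiagram (suc m) n'' m (nonRootOf τ') (θ τ'')
    θ≡ = trans (θ-ladder-graft τ' τ'' i k≡ j≡)
               (cong₂ (λ a b → graftDiagram (suc a) b a (nonRootOf τ') (θ τ'')) size' size'')
    nonRoot↭T' : nonRootOf τ' ↭ T'
    nonRoot↭T' = drop-∷ (subst (_↭ C') (trans (θ-full-root τ' k≡) (cong (λ a → (1 , suc a) ∷ nonRootOf τ') size')) θτ'↭C')
    θ↭C : θ (graft τ' τ'' i) ↭ C
    θ↭C = subst (_↭ C) (sym θ≡)
      (↭-trans (prep _ (++⁺ (map⁺ (mapChord (_+ n'')) nonRoot↭T') (map⁺ (mapChord (shiftOuter n'' m)) θτ''↭C'')))
               (subst (_↭ C) (sym graft≡) (↭-sym C↭root∷A++B)))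

LadderShaped : ℕ → Diagram → Set
LadderShaped n C = IsDiagram n C × SplitAt n C × ¬ Contains213 C × (1 , suc n) ∈ C

chord-at-2 : ∀ {N C} → IsDiagram N C → SplitAt N C → 2 ≤ N → ∃ λ s₂ → (2 , s₂) ∈ C
chord-at-2 D split 2≤N with IsDiagram.covering D {2} (s≤s z≤n) (≤-trans 2≤N (m≤m+n _ _))
... | (a , b) , c∈ , inj₁ refl = b , c∈
... | (a , b) , c∈ , inj₂ refl = ⊥-elim (<⇒≱ (proj₂ (split c∈)) 2≤N)

θ-ladder-surjective : ∀ n {C} → 1 ≤ n → LadderShaped n C → LadderPreimage C
θ-ladder-surjective = <-rec _ surjective
  where
  surjective : ∀ n → (∀ {n′} → n′ < n → ∀ {C} → 1 ≤ n′ → LadderShaped n′ C → LadderPreimage C) →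
               ∀ {C} → 1 ≤ n → LadderShaped n C → LadderPreimage C
  surjective (suc zero) _ _ (D , _) = node [] , vert , single , θ-vert-↭ D
  surjective (suc (suc n₀)) smaller _ (D , split , no213 , root∈) with chord-at-2 D split (s≤s (s≤s z≤n))
  ... | _ , s₂-chord∈ =
    preimage (smaller m<N 1≤m (D' , split' , no213' , here refl))
             (smaller n''<N 1≤n'' (D'' , split'' , no213'' , root''∈))
    where
    open LadderDecomposition D split no213 root∈ s₂-chord∈
    m<N : m < suc (suc n₀)
    m<N = subst (m <_) (sym N≡m+n'') (m<m+n m 1≤n'')
    n''<N : n'' < suc (suc n₀)
    n''<N = subst (n'' <_) (sym N≡m+n'') (m<n+m n'' 1≤m)

rooted⇒isDiagram-suc : ∀ {C} → IsRootedChordDiagram C → Σ ℕ λ n → IsDiagram (suc n) C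
rooted⇒isDiagram-suc {[]}    (nonempty , _) = ⊥-elim (nonempty refl)
rooted⇒isDiagram-suc {c ∷ C} rooted         = length C , rooted⇒isDiagram rooted

leaf-tubings-bijection : RestrictsToBijection IsLeafTubing OneTerminalDiagram
leaf-tubings-bijection = record
  { into       = λ {t} τ leaf → isDiagram⇒rooted (θ-isDiagram τ) (1≤size t) , θ-oneTerminal leaf
  ; injective  = θ-leaf-injective
  ; surjective = λ C (rooted , one) → θ-leaf-surjective _ (proj₂ (rooted⇒isDiagram-suc rooted)) one
  }

ladders-bijection : RestrictsToBijection (λ {t} τ → IsLadder t) Connected213PermDiagram
ladders-bijection = record
  { into       = into
  ; injective  = θ-ladder-injective
  ; surjective = surjective
  }
  where
  into : ∀ {t} (τ : Tubing t) → IsLadder t → Connected213PermDiagram (θ τ)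
  into {t} τ ladder with ladder-invariant τ ladder
  ... | split , k≡ , no213 =
    isDiagram⇒rooted D (1≤size t) ,
    full-root⇒connected D split (subst ((1 , suc (size t)) ∈_) (sym (θ-full-root τ k≡)) (here refl)) ,
    (λ c∈ d∈ → ≤-<-trans (proj₁ (split c∈)) (proj₂ (split d∈))) ,
    no213
    where D = θ-isDiagram τ
  surjective : ∀ C → Connected213PermDiagram C → LadderPreimage C
  surjective C (rooted , connected , permutation , no213) with rooted⇒isDiagram-suc rooted
  ... | n , D = θ-ladder-surjective (suc n) (s≤s z≤n)
                  (D , split , no213 , connected⇒full-root D split no213 connected (s≤s z≤n))
    where split = permutation⇒splitAt D permutation (s≤s z≤n)

proposition5p17 : RestrictsToBijection (λ {t} τ → IsLadder t) Connected213PermDiagram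
                  × RestrictsToBijection IsLeafTubing OneTerminalDiagram
proposition5p17 = ladders-bijection , leaf-tubings-bijection
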